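{- Let $I$ be a common interval of $\mathcal{P}$ with $|I|\ge 2$. Then $I$ is $b$-nested if and only if one of the following holds: (a) $I$ is a $P$-interval and there exists $x_h\in D(I)$ such that $\mathrm{Int}(x_h)$ is a $b$-nested common interval of size at least $|I|-b$; (b) $I$ is a $Q$-interval and all intervals $\mathrm{Int}(x_i)$ with $x_i\in D(I)$ are $b$-small, with at most one exception, which is a $b$-large $b$-nested common interval.
   Context: Let $n,K\geq 1$ and let $\mathcal{P}=\{P_1,\ldots,P_K\}$ be a set of permutations of $\{1,\ldots,n\}$ with $P_1=\mathrm{Id}_n$. For $i\le j$, $(i..j)=\{i,\ldots,j\}$. A common interval of $\mathcal{P}$ is a set of integers occupying consecutive positions in every $P_k$; every common interval has the form $(i..j)$. Fix a positive integer $b$. A common interval $I$ is $b$-nested if $|I|=1$ or $I$ strictly contains a $b$-nested common interval $J$ with $|J|\geq|I|-b$; it is $b$-small if $|I|\le b$ and $b$-large otherwise. Two intervals $(i..j)$, $(k..l)$ overlap if $i<k\le j<l$ or $k<i\le l<j$. A common interval is strong if it overlaps no other common interval. Let $T$ be the inclusion tree of strong common intervals (nodes $x$ correspond bijectively to strong common intervals $\mathrm{Int}(x)$, root $(1..n)$, $x$ parent of $y$ iff $\mathrm{Int}(x)$ is the smallest strong common interval strictly containing $\mathrm{Int}(y)$). A node $x$ with children set $D$ is labeled $P$ if for every $D'\subset D$ with $2\le|D'|<|D|$ the union of $\mathrm{Int}(z)$, $z\in D'$, is not a common interval; otherwise $Q$. The children of a $Q$-node are ordered $y_1,\ldots,y_r$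 with $\max(\mathrm{Int}(y_i))+1=\min(\mathrm{Int}(y_{i+1}))$. It is known that every common interval $I$ is either strong or equals $\bigcup_{h=l}^m\mathrm{Int}(z_h)$ for consecutive children $z_l,\ldots,z_m$ of a unique $Q$-node. The domain $D(I)$ is the set of children of the node of $I$ if $I$ is strong, and $\{z_l,\ldots,z_m\}$ otherwise. A $P$-interval is a strong common interval whose node is labeled $P$; every other common interval is a $Q$-interval. -}

module Defs where

open import Data.Nat using (ℕ; zero; suc; _∸_) renaming (_≤_ to _≤ℕ_; _<_ to _<ℕ_)
open import Data.Fin using (Fin; toℕ; _≤_; _<_)
open import Data.Fin.Permutation using (Permutation′; _⟨$⟩ʳ_)
open import Data.Bool using (Bool; true; false)
open import Data.Product using (Σ; ∃; _×_; _,_; proj₁; proj₂)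
open import Data.Sum using (_⊎_)
open import Relation.Nullary using (¬_)
open import Relation.Binary.PropositionalEquality using (_≡_; _≢_)

-- A family P_1,…,P_K of permutations of the n values, K = suc K'.
-- Values are elements of Fin n (i.e. 0..n-1, an order-preserving relabelling
-- of 1..n); positions are elements of Fin n; P k ⟨$⟩ʳ p is the value at position p.
Perms : ℕ → ℕ → Set
Perms n K = Fin (suc K) → Permutation′ n

FirstIsId : ∀ {n K} → Perms n K → Set
FirstIsId {n} P = ∀ (p : Fin n) → P Fin.zero ⟨$⟩ʳ p ≡ p
  where import Data.Fin as Fin

-- An interval (i..j) is a pair (i , j) (with i ≤ j, imposed by Common)
Interval : ℕ → Set
Interval n = Fin n × Fin n

_∈I_ : ∀ {n} → Fin n → Interval n → Set
v ∈I (i , j) = (i ≤ v) × (v ≤ j)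

size : ∀ {n} → Interval n → ℕ
size (i , j) = suc (toℕ j ∸ toℕ i)

_⊆I_ : ∀ {n} → Interval n → Interval n → Set
(i , j) ⊆I (k , l) = (k ≤ i) × (j ≤ l)

_⊂I_ : ∀ {n} → Interval n → Interval n → Set
I ⊂I J = (I ⊆I J) × (I ≢ J)

Consecutive : ∀ {n} → Permutation′ n → (Fin n → Set) → Set
Consecutive {n} π S =
  ∀ (p q r : Fin n) → p ≤ q → q ≤ r → S (π ⟨$⟩ʳ p) → S (π ⟨$⟩ʳ r) → S (π ⟨$⟩ʳ q)

CommonSet : ∀ {n K} → Perms n K → (Fin n → Set) → Set
CommonSet {n} P S = (Σ (Fin n) S) × (∀ k → Consecutive (P k) S)

Common : ∀ {n K} → Perms n K → Interval n → Set
Common P I = (proj₁ I ≤ proj₂ I) × CommonSet P (λ v → v ∈I I)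

Overlap : ∀ {n} → Interval n → Interval n → Set
Overlap (i , j) (k , l) = ((i < k) × (k ≤ j) × (j < l)) ⊎ ((k < i) × (i ≤ l) × (l < j))

Strong : ∀ {n K} → Perms n K → Interval n → Set
Strong P I = Common P I × (∀ J → Common P J → ¬ Overlap I J)

-- nodes of T are identified with strong intervals; Child P x y : x is the parent of y,
-- i.e. Int(x) is the smallest strong interval strictly containing Int(y)
Child : ∀ {n K} → Perms n K → Interval n → Interval n → Set
Child P x y = Strong P x × Strong P y × (y ⊂I x)
            × (∀ z → Strong P z → y ⊂I z → x ⊆I z)

Union : ∀ {n} → (Interval n → Bool) → Fin n → Set
Union D' v = ∃ λ z → (D' z ≡ true) × (v ∈I z)

LabelP : ∀ {n K} → Perms n K → Interval n → Set
LabelP {n} P x =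
  ∀ (D' : Interval n → Bool) →
    (∀ z → D' z ≡ true → Child P x z) →                       -- D' ⊆ D
    (∃ λ z₁ → ∃ λ z₂ → (D' z₁ ≡ true) × (D' z₂ ≡ true) × (z₁ ≢ z₂)) -- 2 ≤ |D'|
    → (∃ λ z → Child P x z × (D' z ≡ false))                     -- |D'| < |D|
    → ¬ CommonSet P (Union D')

LabelQ : ∀ {n K} → Perms n K → Interval n → Set
LabelQ P x = ¬ LabelP P x

PInterval : ∀ {n K} → Perms n K → Interval n → Set
PInterval P I = Strong P I × LabelP P I

QInterval : ∀ {n K} → Perms n K → Interval n → Set
QInterval P I = Common P I × ¬ PInterval P I

-- I is the union of consecutive children z_l..z_m of the Q-node x
-- (namely of those children of x contained in I)
UnionOfChildrenOf : ∀ {n K} → Perms n K → Interval n → Interval n → Set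
UnionOfChildrenOf P x I =
  Strong P x × LabelQ P x ×
  (∀ v → (v ∈I I → ∃ λ z → Child P x z × z ⊆I I × v ∈I z)
       × ((∃ λ z → Child P x z × z ⊆I I × v ∈I z) → v ∈I I))

InDomain : ∀ {n K} → Perms n K → Interval n → Interval n → Set
InDomain P I z =
  (Strong P I × Child P I z)
  ⊎ (¬ Strong P I × ∃ λ x → UnionOfChildrenOf P x I × Child P x z × z ⊆I I)

data Nested {n K} (P : Perms n K) (b : ℕ) : Interval n → Set where
  single : ∀ I → Common P I → size I ≡ 1 → Nested P b I
  step   : ∀ I J → Common P I → J ⊂I I → Nested P b J → size I ∸ b ≤ℕ size J
         → Nested P b I

Small : ∀ {n} → ℕ → Interval n → Set
Small b I = size I ≤ℕ b

Large : ∀ {n} → ℕ → Interval n → Set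
Large b I = b <ℕ size I

-- Common intervals are handled as half-open ranges [i, j) of values. Strong ranges are laminar, so a
-- strong range X of size at least two is partitioned by its children; the endpoints of the children
-- are the boundaries of X. By the overlap lemmas (the union, intersection and differences of two
-- overlapping common ranges are common), X is a Q-node exactly when some proper block of at least two
-- consecutive children is common, and then every block of consecutive children is common. A common
-- range I that is not strong is such a block of the smallest strong range containing it, so in all
-- cases D(I) consists of consecutive children of one node, covering I.
--
-- If I is b-nested, the chain I ⊃ J ⊃ … of the definition is followed: since |J| ≥ |I| − b, a child
-- of size > b cannot be disjoint from J. In a P-node no proper common range spans two children, so J
-- lies in a child, which inherits nestedness (a). In a Q-node the large child is met by J, hence
-- unique, and it is nested by induction along the chain (b). Conversely, (a) is one nesting step, and
-- under (b) a small child at one end of the block of D(I) can be peeled off, leaving a common block,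
-- until a single child remains.

module Submission where

open import Defs
open import Data.Bool using (Bool; true; false)
import Data.Bool as Bool
open import Data.Empty using (⊥; ⊥-elim)
open import Data.Fin as F using (Fin; toℕ; fromℕ<)
import Data.Fin.Properties as FP
open import Data.Fin.Permutation using (_⟨$⟩ʳ_; _⟨$⟩ˡ_; inverseʳ; inverseˡ)
open import Data.Nat using (ℕ; zero; suc; _+_; _∸_; _⊔_; _≤_; _<_; z≤n; s≤s; s≤s⁻¹; _≤?_; _<?_; _≟_)
open import Data.Nat.Induction using (<-rec)
open import Data.Nat.Properties
open import Data.Product
open import Data.Sum using (_⊎_; inj₁; inj₂; [_,_]′)
open import Function.Bundles using (_⇔_; mk⇔)
open import Relation.Binary.Definitions using (Tri; tri<; tri≈; tri>)
open import Relation.Binary.PropositionalEquality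
open import Relation.Nullary
open import Relation.Nullary.Decidable using (_×-dec_; _⊎-dec_; _→-dec_; ¬?; isYes; map′; decidable-stable)

all²<? : ∀ {G T : ℕ → ℕ → Set} N → (∀ k l → G k l → k < N × l < N) →
         (∀ k l → Dec (G k l)) → (∀ k l → Dec (T k l)) → Dec (∀ k l → G k l → T k l)
all²<? {G} {T} N bounded G? T? with allUpTo? (λ k → allUpTo? (λ l → G? k l →-dec T? k l) N) N
... | yes all = yes (λ k l g → all (proj₁ (bounded k l g)) (proj₂ (bounded k l g)) g)
... | no ¬all = no (λ all → ¬all (λ _ _ g → all _ _ g))

any²<? : ∀ {G : ℕ → ℕ → Set} N → (∀ k l → G k l → k < N × l < N) →
         (∀ k l → Dec (G k l)) → Dec (∃₂ λ k l → G k l)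
any²<? {G} N bounded G? with anyUpTo? (λ k → anyUpTo? (λ l → G? k l) N) N
... | yes (k , _ , l , _ , g) = yes (k , l , g)
... | no none = no (λ { (k , l , g) → none (k , proj₁ (bounded k l g) , l , proj₂ (bounded k l g) , g) })

least : ∀ {Q : ℕ → Set} → (∀ k → Dec (Q k)) → ∀ w → Q w → ∃ λ m → Q m × (∀ v → Q v → m ≤ v)
least {Q} Q? = <-rec (λ w → Q w → ∃ λ m → Q m × (∀ v → Q v → m ≤ v)) search
  where
  search : ∀ w → (∀ {v} → v < w → Q v → ∃ λ m → Q m × (∀ v → Q v → m ≤ v)) →
         Q w → ∃ λ m → Q m × (∀ v → Q v → m ≤ v)
  search w rec qw with anyUpTo? Q? w
  ... | yes (v , v<w , qv) = rec v<w qv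
  ... | no none = w , qw , λ v qv → ≮⇒≥ (λ v<w → none (v , v<w , qv))

greatest : ∀ {Q : ℕ → Set} N → (∀ k → Dec (Q k)) → (∀ k → Q k → k < N) →
           ∀ w → Q w → ∃ λ m → Q m × (∀ v → Q v → v ≤ m)
greatest zero Q? bounded w q = ⊥-elim (n≮0 (bounded w q))
greatest (suc N) Q? bounded w q with Q? N
... | yes qN = N , qN , λ v qv → s≤s⁻¹ (bounded v qv)
... | no ¬qN = greatest N Q? (λ k qk → ≤∧≢⇒< (s≤s⁻¹ (bounded k qk)) (λ { refl → ¬qN qk })) w q

abstract
  maximise : ∀ {Q : ℕ → ℕ → Set} (N M : ℕ) (m : ℕ → ℕ → ℕ) → (∀ k l → Q k l → k < N × l < N) →
             (∀ k l → Dec (Q k l)) → (∀ k l → Q k l → m k l ≤ M) →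
             ∀ a b → Q a b → ∃₂ λ a′ b′ → Q a′ b′ × (∀ k l → Q k l → m k l ≤ m a′ b′)
  maximise {Q} N M m bounded Q? m≤M a b q = climb (M ∸ m a b) a b q ≤-refl
    where
    climb : ∀ fuel a b → Q a b → M ∸ m a b ≤ fuel → ∃₂ λ a′ b′ → Q a′ b′ × (∀ k l → Q k l → m k l ≤ m a′ b′)
    climb fuel a b q lim with any²<? N (λ k l g → bounded k l (proj₁ g)) (λ k l → Q? k l ×-dec (m a b <? m k l))
    ... | no none = a , b , q , λ k l qkl → ≮⇒≥ (λ lt → none (k , l , qkl , lt))
    climb zero a b q lim | yes (k , l , qkl , lt) = ⊥-elim (<⇒≱ (∸-monoʳ-< lt (m≤M k l qkl)) (≤-trans lim z≤n))
    climb (suc fuel) a b q lim | yes (k , l , qkl , lt) =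
      climb fuel k l qkl (s≤s⁻¹ (≤-trans (∸-monoʳ-< lt (m≤M k l qkl)) lim))

isYes≡true⇒ : ∀ {A : Set} (d : Dec A) → isYes d ≡ true → A
isYes≡true⇒ (yes a) _ = a
isYes≡true⇒ (no _) ()

isYes≡true : ∀ {A : Set} (d : Dec A) → A → isYes d ≡ true
isYes≡true (yes _) _ = refl
isYes≡true (no ¬a) a = ⊥-elim (¬a a)

isYes≡false : ∀ {A : Set} (d : Dec A) → ¬ A → isYes d ≡ false
isYes≡false (yes a) ¬a = ⊥-elim (¬a a)
isYes≡false (no _) _ = refl

Within : ℕ → ℕ → ℕ → ℕ → Set
Within i j k l = k ≤ i × j ≤ l

StrictlyWithin : ℕ → ℕ → ℕ → ℕ → Set
StrictlyWithin i j k l = Within i j k l × (k < i ⊎ j < l)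

within? : ∀ i j k l → Dec (Within i j k l)
within? i j k l = (k ≤? i) ×-dec (j ≤? l)

strictlyWithin? : ∀ i j k l → Dec (StrictlyWithin i j k l)
strictlyWithin? i j k l = within? i j k l ×-dec ((k <? i) ⊎-dec (j <? l))

Overlaps : ℕ → ℕ → ℕ → ℕ → Set
Overlaps i j k l = (i < k × k < j × j < l) ⊎ (k < i × i < l × l < j)

overlaps? : ∀ i j k l → Dec (Overlaps i j k l)
overlaps? i j k l = ((i <? k) ×-dec (k <? j) ×-dec (j <? l)) ⊎-dec ((k <? i) ×-dec (i <? l) ×-dec (l <? j))

non-overlapping⇒nested : ∀ {i j k l} → ¬ Overlaps i j k l → i < l → k < j → Within i j k l ⊎ Within k l i j
non-overlapping⇒nested {i} {j} {k} {l} nov il kj with <-cmp i k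
... | tri< i<k _ _ = inj₂ (<⇒≤ i<k , ≮⇒≥ (λ j<l → nov (inj₁ (i<k , kj , j<l))))
... | tri≈ _ refl _ = [ (λ jl → inj₁ (≤-refl , jl)) , (λ lj → inj₂ (≤-refl , lj)) ]′ (≤-total j l)
... | tri> _ _ k<i = inj₁ (<⇒≤ k<i , ≮⇒≥ (λ l<j → nov (inj₂ (k<i , il , l<j))))

within⇒¬strictlyContains : ∀ {i j k l} → Within i j k l → ¬ StrictlyWithin k l i j
within⇒¬strictlyContains (ki , jl) (_ , inj₁ i<k) = <⇒≱ i<k ki
within⇒¬strictlyContains (ki , jl) (_ , inj₂ l<j) = <⇒≱ l<j jl

within⇒≡⊎strictlyWithin : ∀ {i j k l} → Within i j k l → (i ≡ k × j ≡ l) ⊎ StrictlyWithin i j k l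
within⇒≡⊎strictlyWithin {i} {j} {k} {l} s@(ki , jl) with k <? i | j <? l
... | yes k<i | _ = inj₂ (s , inj₁ k<i)
... | no _ | yes j<l = inj₂ (s , inj₂ j<l)
... | no k≮i | no j≮l = inj₁ (≤-antisym (≮⇒≥ k≮i) ki , ≤-antisym jl (≮⇒≥ j≮l))

contains⇒¬overlaps : ∀ {i j k l} → Within k l i j → ¬ Overlaps i j k l
contains⇒¬overlaps (ik , lj) (inj₁ (_ , _ , j<l)) = <⇒≱ j<l lj
contains⇒¬overlaps (ik , lj) (inj₂ (k<i , _ , _)) = <⇒≱ k<i ik

within⇒¬overlaps : ∀ {i j k l} → Within i j k l → ¬ Overlaps i j k l
within⇒¬overlaps (ki , jl) (inj₁ (i<k , _ , _)) = <⇒≱ i<k ki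
within⇒¬overlaps (ki , jl) (inj₂ (_ , _ , l<j)) = <⇒≱ l<j jl

strictlyWithin⇒length< : ∀ {i j k l} → i ≤ j → StrictlyWithin i j k l → j ∸ i < l ∸ k
strictlyWithin⇒length< {i} {j} {k} {l} ij ((ki , jl) , inj₁ k<i) = <-≤-trans (∸-monoʳ-< k<i ij) (∸-monoˡ-≤ k jl)
strictlyWithin⇒length< {i} {j} {k} {l} ij ((ki , jl) , inj₂ j<l) = <-≤-trans (∸-monoˡ-< j<l ij) (∸-monoʳ-≤ l ki)

within-trans : ∀ {a b i j k l} → Within a b i j → Within i j k l → Within a b k l
within-trans (ia , bj) (ki , jl) = ≤-trans ki ia , ≤-trans bj jl

∸-split : ∀ {a b d} → a ≤ b → b ≤ d → (b ∸ a) + (d ∸ b) ≡ d ∸ a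
∸-split {a} {b} {d} a≤b b≤d = begin
  (b ∸ a) + (d ∸ b) ≡⟨ +-comm (b ∸ a) (d ∸ b) ⟩
  (d ∸ b) + (b ∸ a) ≡⟨ +-∸-assoc (d ∸ b) a≤b ⟨
  (d ∸ b) + b ∸ a   ≡⟨ cong (_∸ a) (m∸n+n≡m b≤d) ⟩
  d ∸ a             ∎
  where open ≡-Reasoning

within⇒length≤ : ∀ {a b c d} → Within a b c d → b ∸ a ≤ d ∸ c
within⇒length≤ (ca , bd) = ∸-mono bd ca

disjoint-lengths : ∀ {p₀ p₁ q₀ q₁ u₀ u₁} → Within p₀ p₁ u₀ u₁ → Within q₀ q₁ u₀ u₁ → p₀ ≤ p₁ → q₀ ≤ q₁ →
                   p₁ ≤ q₀ → (p₁ ∸ p₀) + (q₁ ∸ q₀) ≤ u₁ ∸ u₀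
disjoint-lengths {p₀} {p₁} {q₀} {q₁} {u₀} {u₁} (u₀≤p₀ , _) (_ , q₁≤u₁) p₀≤p₁ q₀≤q₁ p₁≤q₀ = begin
  (p₁ ∸ p₀) + (q₁ ∸ q₀) ≤⟨ +-monoʳ-≤ (p₁ ∸ p₀) (∸-monoʳ-≤ q₁ p₁≤q₀) ⟩
  (p₁ ∸ p₀) + (q₁ ∸ p₁) ≡⟨ ∸-split p₀≤p₁ (≤-trans p₁≤q₀ q₀≤q₁) ⟩
  q₁ ∸ p₀               ≤⟨ within⇒length≤ (u₀≤p₀ , q₁≤u₁) ⟩
  u₁ ∸ u₀               ∎
  where open ≤-Reasoning

-- Disjoint, they would give |U| ≥ |J| + |Y| > (|U| − β) + β.
long-meets-large : ∀ {β u₀ u₁ k l y₀ y₁} → Within k l u₀ u₁ → Within y₀ y₁ u₀ u₁ → k ≤ l → y₀ ≤ y₁ →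
                   (u₁ ∸ u₀) ∸ β ≤ l ∸ k → β < y₁ ∸ y₀ → y₀ < l × k < y₁
long-meets-large {β} {u₀} {u₁} {k} {l} {y₀} {y₁} J⊆U Y⊆U k≤l y₀≤y₁ long large = meets (y₀ <? l) (k <? y₁)
  where
  too-long : ∀ {m} → m + (y₁ ∸ y₀) ≤ u₁ ∸ u₀ → (u₁ ∸ u₀) ∸ β ≤ m → ⊥
  too-long {m} sum≤U U∸β≤m = <⇒≱ (<-≤-trans (≤-<-trans (m+n≤o⇒m≤o∸n m sum≤U) (∸-monoʳ-< large (≤-trans (m≤n+m (y₁ ∸ y₀) m) sum≤U))) U∸β≤m) ≤-refl
  meets : Dec (y₀ < l) → Dec (k < y₁) → y₀ < l × k < y₁
  meets (yes y₀<l) (yes k<y₁) = y₀<l , k<y₁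
  meets (no y₀≮l) _ = ⊥-elim (too-long (disjoint-lengths J⊆U Y⊆U k≤l y₀≤y₁ (≮⇒≥ y₀≮l)) long)
  meets (yes _) (no k≮y₁) = ⊥-elim (too-long (subst (_≤ u₁ ∸ u₀) (+-comm (y₁ ∸ y₀) (l ∸ k)) (disjoint-lengths Y⊆U J⊆U y₀≤y₁ k≤l (≮⇒≥ k≮y₁))) long)

small-step-left : ∀ {x y β} → x ≤ β → (x + y) ∸ β ≤ y
small-step-left {x} {y} {β} x≤β = ≤-trans (∸-monoˡ-≤ β (+-monoˡ-≤ y x≤β)) (≤-reflexive (m+n∸m≡n β y))

small-step-right : ∀ {x y β} → y ≤ β → (x + y) ∸ β ≤ x
small-step-right {x} {y} {β} y≤β = subst (λ z → z ∸ β ≤ x) (+-comm y x) (small-step-left {y} {x} {β} y≤β)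

module Ranges {n K : ℕ} (P : Perms n K) where

  position : Fin (suc K) → Fin n → Fin n
  position k w = P k ⟨$⟩ˡ w

  at-position : ∀ {A : Fin n → Set} k w → A w → A (P k ⟨$⟩ʳ position k w)
  at-position {A} k w a = subst A (sym (inverseʳ (P k))) a

  abstract
    common-resp : ∀ {A B : Fin n → Set} → (∀ v → A v → B v) → (∀ v → B v → A v) → CommonSet P A → CommonSet P B
    common-resp f g ((w , aw) , cons) = (w , f w aw) , λ k p q r pq qr bp br → f _ (cons k p q r pq qr (g _ bp) (g _ br))

    common-∩ : ∀ {A B : Fin n → Set} → CommonSet P A → CommonSet P B → ∃ (λ v → A v × B v) →
               CommonSet P (λ v → A v × B v)
    common-∩ (_ , ca) (_ , cb) (w , aw , bw) =
      (w , aw , bw) , λ k p q r pq qr ab₁ ab₂ → ca k p q r pq qr (proj₁ ab₁) (proj₁ ab₂) , cb k p q r pq qr (proj₂ ab₁) (proj₂ ab₂)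

    -- A position between an element of A and one of B lies between one of them and the common element w.
    common-∪ : ∀ {A B : Fin n → Set} → CommonSet P A → CommonSet P B → ∃ (λ v → A v × B v) →
               CommonSet P (λ v → A v ⊎ B v)
    common-∪ {A} {B} (_ , ca) (_ , cb) (w , aw , bw) = (w , inj₁ aw) , consecutive
      where
      consecutive : ∀ k → Consecutive (P k) (λ v → A v ⊎ B v)
      consecutive k p q r pq qr (inj₁ ap) (inj₁ ar) = inj₁ (ca k p q r pq qr ap ar)
      consecutive k p q r pq qr (inj₂ bp) (inj₂ br) = inj₂ (cb k p q r pq qr bp br)
      consecutive k p q r pq qr (inj₁ ap) (inj₂ br) with FP.≤-total (position k w) q
      ... | inj₁ sq = inj₂ (cb k (position k w) q r sq qr (at-position {B} k w bw) br)
      ... | inj₂ qs = inj₁ (ca k p q (position k w) pq qs ap (at-position {A} k w aw))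
      consecutive k p q r pq qr (inj₂ bp) (inj₁ ar) with FP.≤-total (position k w) q
      ... | inj₁ sq = inj₁ (ca k (position k w) q r sq qr (at-position {A} k w aw) ar)
      ... | inj₂ qs = inj₂ (cb k p q (position k w) pq qs bp (at-position {B} k w bw))

    -- B is consecutive and contains w ∉ A: a q ∈ B between two elements of A ∖ B would put w between them, hence in A.
    common-∖ : ∀ {A B : Fin n → Set} → CommonSet P A → CommonSet P B → ∃ (λ w → B w × ¬ A w) →
               ∃ (λ v → A v × ¬ B v) → CommonSet P (λ v → A v × ¬ B v)
    common-∖ {A} {B} (_ , ca) (_ , cb) (w , bw , ¬aw) (v , av , ¬bv) = (v , av , ¬bv) , consecutive
      where
      ¬between : ∀ k p q r → p F.≤ q → q F.≤ r → A (P k ⟨$⟩ʳ p) → ¬ B (P k ⟨$⟩ʳ p) →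
                 A (P k ⟨$⟩ʳ r) → ¬ B (P k ⟨$⟩ʳ r) → ¬ B (P k ⟨$⟩ʳ q)
      ¬between k p q r pq qr ap ¬bp ar ¬br bq with FP.≤-total (position k w) p
      ... | inj₁ sp = ¬bp (cb k (position k w) p q sp pq (at-position {B} k w bw) bq)
      ... | inj₂ ps with FP.≤-total r (position k w)
      ... | inj₁ rs = ¬br (cb k q r (position k w) qr rs bq (at-position {B} k w bw))
      ... | inj₂ sr = ¬aw (subst A (inverseʳ (P k)) (ca k p (position k w) r ps sr ap ar))
      consecutive : ∀ k → Consecutive (P k) (λ v → A v × ¬ B v)
      consecutive k p q r pq qr (ap , ¬bp) (ar , ¬br) = ca k p q r pq qr ap ar , ¬between k p q r pq qr ap ¬bp ar ¬br

  -- Ranges are half-open: IsCommon i j says that the values i, …, j − 1 form a common interval.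
  InRange : ℕ → ℕ → Fin n → Set
  InRange i j v = i ≤ toℕ v × toℕ v < j

  IsCommon : ℕ → ℕ → Set
  IsCommon i j = j ≤ n × CommonSet P (InRange i j)

  isCommon⇒< : ∀ {i j} → IsCommon i j → i < j
  isCommon⇒< (_ , (v , iv , vj) , _) = ≤-<-trans iv vj

  value-in-range : ∀ {i j m} → i ≤ m → m < j → j ≤ n → ∃ λ v → toℕ v ≡ m × InRange i j v
  value-in-range im mj jn = fromℕ< (<-≤-trans mj jn) , FP.toℕ-fromℕ< _ , subst (λ x → _ ≤ x × x < _) (sym (FP.toℕ-fromℕ< _)) (im , mj)

  module _ {i j k l : ℕ} (cij : IsCommon i j) (ckl : IsCommon k l) (ik : i < k) (kj : k < j) (jl : j < l) where
    private
      A = InRange i j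
      B = InRange k l
      at-i : ∃ λ v → A v × ¬ B v
      at-i with value-in-range ≤-refl (<-trans ik kj) (proj₁ cij)
      ... | v , refl , av = v , av , λ bv → <⇒≱ ik (proj₁ bv)
      at-k : ∃ λ v → A v × B v
      at-k with value-in-range (<⇒≤ ik) kj (proj₁ cij)
      ... | v , refl , av = v , av , ≤-refl , <-trans kj jl
      at-j : ∃ λ v → B v × ¬ A v
      at-j with value-in-range (<⇒≤ kj) jl (proj₁ ckl)
      ... | v , refl , bv = v , bv , λ av → <-irrefl refl (proj₂ av)
    abstract
      overlap-left : IsCommon i k
      overlap-left = ≤-trans (<⇒≤ kj) (proj₁ cij) , common-resp to from (common-∖ (proj₂ cij) (proj₂ ckl) at-j at-i)
        where
        to : ∀ v → A v × ¬ B v → InRange i k v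
        to v ((iv , vj) , ¬bv) with k ≤? toℕ v
        ... | yes kv = ⊥-elim (¬bv (kv , <-trans vj jl))
        ... | no k≰v = iv , ≰⇒> k≰v
        from : ∀ v → InRange i k v → A v × ¬ B v
        from v (iv , vk) = (iv , <-trans vk kj) , λ bv → <⇒≱ vk (proj₁ bv)

      overlap-middle : IsCommon k j
      overlap-middle = proj₁ cij , common-resp to from (common-∩ (proj₂ cij) (proj₂ ckl) at-k)
        where
        to : ∀ v → A v × B v → InRange k j v
        to v ((iv , vj) , (kv , vl)) = kv , vj
        from : ∀ v → InRange k j v → A v × B v
        from v (kv , vj) = (≤-trans (<⇒≤ ik) kv , vj) , (kv , <-trans vj jl)

      overlap-right : IsCommon j l
      overlap-right = proj₁ ckl , common-resp to from (common-∖ (proj₂ ckl) (proj₂ cij) at-i at-j)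
        where
        to : ∀ v → B v × ¬ A v → InRange j l v
        to v ((kv , vl) , ¬av) with j ≤? toℕ v
        ... | yes jv = jv , vl
        ... | no j≰v = ⊥-elim (¬av (≤-trans (<⇒≤ ik) kv , ≰⇒> j≰v))
        from : ∀ v → InRange j l v → B v × ¬ A v
        from v (jv , vl) = (≤-trans (<⇒≤ kj) jv , vl) , λ av → <⇒≱ (proj₂ av) jv

      overlap-union : IsCommon i l
      overlap-union = proj₁ ckl , common-resp to from (common-∪ (proj₂ cij) (proj₂ ckl) at-k)
        where
        to : ∀ v → A v ⊎ B v → InRange i l v
        to v (inj₁ (iv , vj)) = iv , <-trans vj jl
        to v (inj₂ (kv , vl)) = ≤-trans (<⇒≤ ik) kv , vl
        from : ∀ v → InRange i l v → A v ⊎ B v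
        from v (iv , vl) with toℕ v <? j
        ... | yes vj = inj₁ (iv , vj)
        ... | no v≮j = inj₂ (≤-trans (<⇒≤ kj) (≮⇒≥ v≮j) , vl)

  consecutive? : ∀ {A : Fin n → Set} → (∀ v → Dec (A v)) → ∀ k → Dec (Consecutive (P k) A)
  consecutive? A? k = FP.all? λ p → FP.all? λ q → FP.all? λ r →
    (p F.≤? q) →-dec (q F.≤? r) →-dec A? _ →-dec A? _ →-dec A? _

  commonSet? : ∀ {A : Fin n → Set} → (∀ v → Dec (A v)) → Dec (CommonSet P A)
  commonSet? A? = FP.any? A? ×-dec FP.all? (consecutive? A?)

  isCommon? : ∀ i j → Dec (IsCommon i j)
  isCommon? i j = (j ≤? n) ×-dec commonSet? (λ v → (i ≤? toℕ v) ×-dec (toℕ v <? j))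

  isCommon-bounded : ∀ k l → IsCommon k l → k < suc n × l < suc n
  isCommon-bounded k l c = ≤-trans (isCommon⇒< c) (m≤n⇒m≤1+n (proj₁ c)) , s≤s (proj₁ c)

  abstract
    isCommon-singleton : ∀ i → i < n → IsCommon i (suc i)
    isCommon-singleton i i<n = i<n , ((v , ≤-reflexive (sym v≡i) , s≤s (≤-reflexive v≡i)) , consecutive)
      where
      v : Fin n
      v = fromℕ< i<n
      v≡i : toℕ v ≡ i
      v≡i = FP.toℕ-fromℕ< i<n
      the-value : ∀ {w : Fin n} → InRange i (suc i) w → toℕ w ≡ i
      the-value (iw , wi) = ≤-antisym (s≤s⁻¹ wi) iw
      consecutive : ∀ k → Consecutive (P k) (InRange i (suc i))
      consecutive k p q r pq qr ip ir = ≤-reflexive (sym q↦i) , s≤s (≤-reflexive q↦i)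
        where
        p≡r : p ≡ r
        p≡r = trans (sym (inverseˡ (P k))) (trans (cong (P k ⟨$⟩ˡ_) (FP.toℕ-injective (trans (the-value ip) (sym (the-value ir))))) (inverseˡ (P k)))
        q↦i : toℕ (P k ⟨$⟩ʳ q) ≡ i
        q↦i = trans (cong (λ z → toℕ (P k ⟨$⟩ʳ z)) (FP.toℕ-injective (≤-antisym (subst (λ z → toℕ q ≤ toℕ z) (sym p≡r) qr) pq))) (the-value ip)

    isCommon-whole : 0 < n → IsCommon 0 n
    isCommon-whole 0<n = ≤-refl , (fromℕ< 0<n , z≤n , FP.toℕ<n _) , λ k p q r _ _ _ _ → z≤n , FP.toℕ<n _

  TakesValue : (Fin n → Set) → ℕ → Set
  TakesValue A k = ∃ λ v → toℕ v ≡ k × A v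

  takesValue? : ∀ {A : Fin n → Set} → (∀ v → Dec (A v)) → ∀ k → Dec (TakesValue A k)
  takesValue? A? k = FP.any? (λ v → (toℕ v ≟ k) ×-dec A? v)

  -- In P₁ = Id positions are values, so a common set of values is a range.
  commonSet⇒range : FirstIsId P → ∀ {A : Fin n → Set} → (∀ v → Dec (A v)) → CommonSet P A →
                    ∃₂ λ i j → IsCommon i j × (∀ v → A v → InRange i j v) × (∀ v → InRange i j v → A v)
  commonSet⇒range P₁≡id {A} A? common@((w , aw) , consecutive)
    with least (takesValue? A?) (toℕ w) (w , refl , aw)
       | greatest n (takesValue? A?) (λ k (v , v≡k , _) → subst (_< n) v≡k (FP.toℕ<n v)) (toℕ w) (w , refl , aw)
  ... | i , (vi , refl , avi) , i-least | M , (vM , refl , avM) , M-greatest = toℕ vi , suc (toℕ vM) , (FP.toℕ<n vM , common-resp to from common) , to , from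
    where
    to : ∀ v → A v → InRange (toℕ vi) (suc (toℕ vM)) v
    to v av = i-least (toℕ v) (v , refl , av) , s≤s (M-greatest (toℕ v) (v , refl , av))
    from : ∀ v → InRange (toℕ vi) (suc (toℕ vM)) v → A v
    from v (vi≤v , v≤vM) = subst A (P₁≡id v) (consecutive F.zero vi v vM vi≤v (s≤s⁻¹ v≤vM) (subst A (sym (P₁≡id vi)) avi) (subst A (sym (P₁≡id vM)) avM))

  IsStrong : ℕ → ℕ → Set
  IsStrong i j = IsCommon i j × (∀ k l → IsCommon k l → ¬ Overlaps i j k l)

  isStrong? : ∀ i j → Dec (IsStrong i j)
  isStrong? i j = isCommon? i j ×-dec all²<? (suc n) isCommon-bounded isCommon? (λ k l → ¬? (overlaps? i j k l))

  abstract
    overlapping-partner : ∀ {i j} → IsCommon i j → ¬ IsStrong i j → ∃₂ λ k l → IsCommon k l × Overlaps i j k l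
    overlapping-partner {i} {j} c ¬strong
      with any²<? (suc n) (λ k l g → isCommon-bounded k l (proj₁ g)) (λ k l → isCommon? k l ×-dec overlaps? i j k l)
    ... | yes partner = partner
    ... | no none = ⊥-elim (¬strong (c , λ k l ckl ov → none (k , l , ckl , ov)))

  IsChild : ℕ → ℕ → ℕ → ℕ → Set
  IsChild x₀ x₁ y₀ y₁ = IsStrong x₀ x₁ × IsStrong y₀ y₁ × StrictlyWithin y₀ y₁ x₀ x₁
                      × (∀ z₀ z₁ → IsStrong z₀ z₁ → StrictlyWithin y₀ y₁ z₀ z₁ → Within x₀ x₁ z₀ z₁)

  isChild? : ∀ x₀ x₁ y₀ y₁ → Dec (IsChild x₀ x₁ y₀ y₁)
  isChild? x₀ x₁ y₀ y₁ = isStrong? x₀ x₁ ×-dec isStrong? y₀ y₁ ×-dec strictlyWithin? y₀ y₁ x₀ x₁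
    ×-dec all²<? (suc n) (λ k l s → isCommon-bounded k l (proj₁ s)) isStrong? (λ k l → strictlyWithin? y₀ y₁ k l →-dec within? x₀ x₁ k l)

  strong-nested : ∀ {i j k l} → IsStrong i j → IsCommon k l → i < l → k < j → Within i j k l ⊎ Within k l i j
  strong-nested (_ , nov) ckl il kj = non-overlapping⇒nested (nov _ _ ckl) il kj

  abstract
    siblings-intersecting⇒equal : ∀ {x₀ x₁ y₀ y₁ z₀ z₁} → IsChild x₀ x₁ y₀ y₁ → IsChild x₀ x₁ z₀ z₁ →
                                  y₀ < z₁ → z₀ < y₁ → y₀ ≡ z₀ × y₁ ≡ z₁
    siblings-intersecting⇒equal (_ , sty , psy , miny) (_ , stz , psz , minz) yz zy
      with strong-nested sty (proj₁ stz) yz zy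
    ... | inj₁ y⊆z = [ (λ e → e) , (λ y⊂z → ⊥-elim (within⇒¬strictlyContains (miny _ _ stz y⊂z) psz)) ]′ (within⇒≡⊎strictlyWithin y⊆z)
    ... | inj₂ z⊆y = [ (λ { (e₀ , e₁) → sym e₀ , sym e₁ }) , (λ z⊂y → ⊥-elim (within⇒¬strictlyContains (minz _ _ sty z⊂y) psy)) ]′ (within⇒≡⊎strictlyWithin z⊆y)

module Translate {n K : ℕ} (P : Perms n K) where
  open Ranges P

  lo : Interval n → ℕ
  lo I = toℕ (proj₁ I)

  hi : Interval n → ℕ
  hi I = suc (toℕ (proj₂ I))

  ∈I→ : ∀ {v : Fin n} (I : Interval n) → v ∈I I → InRange (lo I) (hi I) v
  ∈I→ I m = proj₁ m , s≤s (proj₂ m)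

  ∈I← : ∀ {v : Fin n} (I : Interval n) → InRange (lo I) (hi I) v → v ∈I I
  ∈I← I m = proj₁ m , s≤s⁻¹ (proj₂ m)

  common→ : ∀ {I} → Common P I → IsCommon (lo I) (hi I)
  common→ {I} com = FP.toℕ<n (proj₂ I) , common-resp (λ v → ∈I→ I) (λ v → ∈I← I) (proj₂ com)

  common← : ∀ {I} → IsCommon (lo I) (hi I) → Common P I
  common← {I} c = s≤s⁻¹ (isCommon⇒< c) , common-resp (λ v → ∈I← I) (λ v → ∈I→ I) (proj₂ c)

  record Realised (i j : ℕ) : Set where
    constructor realised
    field
      interval : Interval n
      lo-≡ : lo interval ≡ i
      hi-≡ : hi interval ≡ j

  realise : ∀ {i j} → IsCommon i j → Realised i j
  realise {i} {zero} c = ⊥-elim (n≮0 (isCommon⇒< c))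
  realise {i} {suc j} c = realised (fromℕ< (<-≤-trans (isCommon⇒< c) (proj₁ c)) , fromℕ< (proj₁ c)) (FP.toℕ-fromℕ< _) (cong suc (FP.toℕ-fromℕ< _))

  realised-transport : ∀ {a b} (r : Realised a b) (F : ℕ → ℕ → Set) → F a b → F (lo (Realised.interval r)) (hi (Realised.interval r))
  realised-transport (realised _ refl refl) F f = f

  overlap→ : ∀ {I J} → Overlap I J → Overlaps (lo I) (hi I) (lo J) (hi J)
  overlap→ (inj₁ (a , b , c)) = inj₁ (a , s≤s b , s≤s c)
  overlap→ (inj₂ (a , b , c)) = inj₂ (a , s≤s b , s≤s c)

  overlap← : ∀ {I J} → Overlaps (lo I) (hi I) (lo J) (hi J) → Overlap I J
  overlap← (inj₁ (a , b , c)) = inj₁ (a , s≤s⁻¹ b , s≤s⁻¹ c)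
  overlap← (inj₂ (a , b , c)) = inj₂ (a , s≤s⁻¹ b , s≤s⁻¹ c)

  strong→ : ∀ {I} → Strong P I → IsStrong (lo I) (hi I)
  strong→ {I} (com , nov) = common→ com , λ k l ckl ov → via-realised k l ckl ov (realise ckl)
    where
    via-realised : ∀ k l → IsCommon k l → Overlaps (lo I) (hi I) k l → Realised k l → ⊥
    via-realised k l ckl ov (realised J refl refl) = nov J (common← ckl) (overlap← ov)

  strong← : ∀ {I} → IsStrong (lo I) (hi I) → Strong P I
  strong← (c , nov) = common← c , λ J comJ ovl → nov _ _ (common→ comJ) (overlap→ ovl)

  ⊆→ : ∀ {I J} → I ⊆I J → Within (lo I) (hi I) (lo J) (hi J)
  ⊆→ (a , b) = a , s≤s b

  ⊆← : ∀ {I J} → Within (lo I) (hi I) (lo J) (hi J) → I ⊆I J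
  ⊆← (a , b) = a , s≤s⁻¹ b

  interval-≡ : ∀ {I J} → lo I ≡ lo J → hi I ≡ hi J → I ≡ J
  interval-≡ {a , b} {c , d} lo≡ hi≡ = cong₂ _,_ (FP.toℕ-injective lo≡) (FP.toℕ-injective (suc-injective hi≡))

  ⊂→ : ∀ {I J} → I ⊂I J → StrictlyWithin (lo I) (hi I) (lo J) (hi J)
  ⊂→ {I} {J} (I⊆J , I≢J) = [ (λ { (lo≡ , hi≡) → ⊥-elim (I≢J (interval-≡ lo≡ hi≡)) }) , (λ I⊂J → I⊂J) ]′ (within⇒≡⊎strictlyWithin (⊆→ {I} {J} I⊆J))

  ⊂← : ∀ {I J} → StrictlyWithin (lo I) (hi I) (lo J) (hi J) → I ⊂I J
  ⊂← {I} {J} (I⊆J , strict) = ⊆← {I} {J} I⊆J , λ I≡J → not-strict I≡J strict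
    where
    not-strict : I ≡ J → ¬ (lo J < lo I ⊎ hi I < hi J)
    not-strict refl (inj₁ lo<lo) = <-irrefl refl lo<lo
    not-strict refl (inj₂ hi<hi) = <-irrefl refl hi<hi

  child→ : ∀ {x y} → Child P x y → IsChild (lo x) (hi x) (lo y) (hi y)
  child→ {x} {y} (sx , sy , y⊂x , minimal) = strong→ sx , strong→ sy , ⊂→ y⊂x , λ z₀ z₁ stz y⊂z → via-realised z₀ z₁ stz y⊂z (realise (proj₁ stz))
    where
    via-realised : ∀ z₀ z₁ → IsStrong z₀ z₁ → StrictlyWithin (lo y) (hi y) z₀ z₁ → Realised z₀ z₁ → Within (lo x) (hi x) z₀ z₁
    via-realised z₀ z₁ stz y⊂z (realised Z refl refl) = ⊆→ {x} {Z} (minimal Z (strong← stz) (⊂← {y} {Z} y⊂z))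

  child← : ∀ {x y} → IsChild (lo x) (hi x) (lo y) (hi y) → Child P x y
  child← {x} {y} (sx , sy , ps , minz) = strong← sx , strong← sy , ⊂← {y} {x} ps , λ Z stZ yZ → ⊆← {x} {Z} (minz _ _ (strong→ stZ) (⊂→ {y} {Z} yZ))

  size≡hi∸lo : ∀ (I : Interval n) → proj₁ I F.≤ proj₂ I → size I ≡ hi I ∸ lo I
  size≡hi∸lo I le = sym (+-∸-assoc 1 le)

  realised-length : ∀ {a b} (r : Realised a b) → a < b → size (Realised.interval r) ≡ b ∸ a
  realised-length (realised J refl refl) lo<hi = size≡hi∸lo J (s≤s⁻¹ lo<hi)

  data IsNested (b : ℕ) : ℕ → ℕ → Set where
    nsingle : ∀ i → IsCommon i (suc i) → IsNested b i (suc i)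
    nstep : ∀ {i j k l} → IsCommon i j → StrictlyWithin k l i j → IsNested b k l → (j ∸ i) ∸ b ≤ l ∸ k → IsNested b i j

  isNested⇒isCommon : ∀ {b i j} → IsNested b i j → IsCommon i j
  isNested⇒isCommon (nsingle i c) = c
  isNested⇒isCommon (nstep c _ _ _) = c

  nested-within : ∀ {b k l i j} → IsNested b k l → IsCommon i j → Within k l i j → (j ∸ i) ∸ b ≤ l ∸ k → IsNested b i j
  nested-within {b} nested-J cij J⊆I long with within⇒≡⊎strictlyWithin J⊆I
  ... | inj₁ (refl , refl) = nested-J
  ... | inj₂ J⊂I = nstep cij J⊂I nested-J long

  nested⇒common : ∀ {b I} → Nested P b I → Common P I
  nested⇒common (single I c _) = c
  nested⇒common (step I J c _ _ _) = c

  nested→ : ∀ {b I} → Nested P b I → IsNested b (lo I) (hi I)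
  nested→ {b} (single I com size≡1) = subst (IsNested b (lo I)) (sym hi≡) (nsingle (lo I) (subst (IsCommon (lo I)) hi≡ (common→ com)))
    where
    hi≡ : hi I ≡ suc (lo I)
    hi≡ = cong suc (≤-antisym (m∸n≡0⇒m≤n (suc-injective size≡1)) (proj₁ com))
  nested→ {b} (step I J com J⊂I nested-J long) =
    nstep (common→ com) (⊂→ J⊂I) (nested→ nested-J) (subst₂ (λ u v → u ∸ b ≤ v) (size≡hi∸lo I (proj₁ com)) (size≡hi∸lo J (proj₁ (nested⇒common nested-J))) long)

  nested← : ∀ {b i j} → IsNested b i j → (I : Interval n) → lo I ≡ i → hi I ≡ j → Nested P b I
  nested← (nsingle i c) I refl hi≡ = single I com (trans (size≡hi∸lo I (proj₁ com)) (trans (cong (_∸ lo I) hi≡) (m+n∸n≡m 1 (lo I))))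
    where
    com : Common P I
    com = common← (subst (IsCommon (lo I)) (sym hi≡) c)
  nested← {b} (nstep {i} {j} {k} {l} c J⊂I nested-J long) I refl refl = via-realised (realise (isNested⇒isCommon nested-J))
    where
    via-realised : Realised k l → Nested P b I
    via-realised (realised J refl refl) =
      step I J (common← c) (⊂← {J} {I} J⊂I) (nested← nested-J J refl refl)
           (subst₂ (λ u v → u ∸ b ≤ v) (sym (size≡hi∸lo I (s≤s⁻¹ (isCommon⇒< c)))) (sym (size≡hi∸lo J (s≤s⁻¹ (isCommon⇒< (isNested⇒isCommon nested-J))))) long)

module Node {n K : ℕ} (P : Perms n K) (X₀ X₁ : ℕ) (stX : Ranges.IsStrong P X₀ X₁) (bigX : suc X₀ < X₁) where
  open Ranges P

  ChildOfX : ℕ → ℕ → Set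
  ChildOfX = IsChild X₀ X₁

  X₁≤n : X₁ ≤ n
  X₁≤n = proj₁ (proj₁ stX)

  -- Boundary c: c lies in [X₀, X₁] but strictly inside no child, i.e. it is an endpoint of children.
  Boundary : ℕ → Set
  Boundary c = X₀ ≤ c × c ≤ X₁ × (∀ a b → ChildOfX a b → ¬ (a < c × c < b))

  boundary-≥X₀ : ∀ {c} → Boundary c → X₀ ≤ c
  boundary-≥X₀ = proj₁

  boundary-≤X₁ : ∀ {c} → Boundary c → c ≤ X₁
  boundary-≤X₁ bc = proj₁ (proj₂ bc)

  boundary-not-inside : ∀ {c a b} → Boundary c → ChildOfX a b → ¬ (a < c × c < b)
  boundary-not-inside bc = proj₂ (proj₂ bc) _ _

  boundary? : ∀ c → Dec (Boundary c)
  boundary? c = (X₀ ≤? c) ×-dec (c ≤? X₁) ×-dec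
    all²<? (suc n) (λ a b ch → isCommon-bounded a b (proj₁ (proj₁ (proj₂ ch)))) (isChild? X₀ X₁) (λ a b → ¬? ((a <? c) ×-dec (c <? b)))

  boundary-X₀ : Boundary X₀
  boundary-X₀ = ≤-refl , <⇒≤ (<-trans ≤-refl bigX) , λ a b ch p → <⇒≱ (proj₁ p) (proj₁ (proj₁ (proj₁ (proj₂ (proj₂ ch)))))

  boundary-X₁ : Boundary X₁
  boundary-X₁ = <⇒≤ (<-trans ≤-refl bigX) , ≤-refl , λ a b ch p → <⇒≱ (proj₂ p) (proj₂ (proj₁ (proj₁ (proj₂ (proj₂ ch)))))

  child-strong : ∀ {a b} → ChildOfX a b → IsStrong a b
  child-strong ch = proj₁ (proj₂ ch)

  child-common : ∀ {a b} → ChildOfX a b → IsCommon a b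
  child-common ch = proj₁ (child-strong ch)

  child-< : ∀ {a b} → ChildOfX a b → a < b
  child-< ch = isCommon⇒< (child-common ch)

  child-within : ∀ {a b} → ChildOfX a b → Within a b X₀ X₁
  child-within ch = proj₁ (proj₁ (proj₂ (proj₂ ch)))

  child-maximal : ∀ {a b} → ChildOfX a b → ∀ z₀ z₁ → IsStrong z₀ z₁ → StrictlyWithin a b z₀ z₁ → Within X₀ X₁ z₀ z₁
  child-maximal ch = proj₂ (proj₂ (proj₂ ch))

  abstract
    -- A longest strong range strictly inside [X₀, X₁] around v is a child; [v, v + 1) is a candidate.
    covering-child : ∀ v → X₀ ≤ v → v < X₁ → ∃₂ λ a b → ChildOfX a b × a ≤ v × v < b
    covering-child v X₀≤v v<X₁
      with maximise {Candidate} (suc n) n (λ a b → b ∸ a) (λ a b q → isCommon-bounded a b (proj₁ (proj₁ q))) candidate?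
                    (λ a b q → ≤-trans (m∸n≤m b a) (proj₁ (proj₁ (proj₁ q)))) v (suc v) singleton
      where
      Candidate : ℕ → ℕ → Set
      Candidate a b = IsStrong a b × StrictlyWithin a b X₀ X₁ × a ≤ v × v < b
      candidate? : ∀ a b → Dec (Candidate a b)
      candidate? a b = isStrong? a b ×-dec strictlyWithin? a b X₀ X₁ ×-dec (a ≤? v) ×-dec (v <? b)
      singleton-strong : ∀ k l → IsCommon k l → ¬ Overlaps v (suc v) k l
      singleton-strong k l _ (inj₁ (v<k , k<sv , _)) = <⇒≱ v<k (s≤s⁻¹ k<sv)
      singleton-strong k l _ (inj₂ (k<v , v<l , l<sv)) = <⇒≱ v<l (s≤s⁻¹ l<sv)
      singleton-proper : X₀ < v ⊎ suc v < X₁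
      singleton-proper with X₀ <? v
      ... | yes X₀<v = inj₁ X₀<v
      ... | no X₀≮v = inj₂ (subst (λ z → suc z < X₁) (≤-antisym X₀≤v (≮⇒≥ X₀≮v)) bigX)
      singleton : Candidate v (suc v)
      singleton = (isCommon-singleton v (<-≤-trans v<X₁ X₁≤n) , singleton-strong) , ((X₀≤v , v<X₁) , singleton-proper) , ≤-refl , ≤-refl
    ... | a , b , (sta , a⊂X , av , vb) , longest = a , b , (stX , sta , a⊂X , maximal) , av , vb
      where
      maximal : ∀ z₀ z₁ → IsStrong z₀ z₁ → StrictlyWithin a b z₀ z₁ → Within X₀ X₁ z₀ z₁
      maximal z₀ z₁ stz a⊂z
        with strong-nested stX (proj₁ stz) (≤-<-trans X₀≤v (<-≤-trans vb (proj₂ (proj₁ a⊂z))))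
                                           (≤-<-trans (≤-trans (proj₁ (proj₁ a⊂z)) av) v<X₁)
      ... | inj₁ X⊆z = X⊆z
      ... | inj₂ z⊆X with within⇒≡⊎strictlyWithin z⊆X
      ...   | inj₁ (e₀ , e₁) = ≤-reflexive e₀ , ≤-reflexive (sym e₁)
      ...   | inj₂ z⊂X = ⊥-elim (<⇒≱ (strictlyWithin⇒length< (<⇒≤ (isCommon⇒< (proj₁ sta))) a⊂z)
                                      (longest z₀ z₁ (stz , z⊂X , ≤-trans (proj₁ (proj₁ a⊂z)) av , <-≤-trans vb (proj₂ (proj₁ a⊂z)))))

  abstract
    child-endpoints-boundary : ∀ {a b} → ChildOfX a b → Boundary a × Boundary b
    child-endpoints-boundary {a} {b} ch =
        (X₀≤a , ≤-trans (<⇒≤ a<b) b≤X₁ , λ a′ b′ ch′ p → <-irrefl (sym (proj₁ (siblings-intersecting⇒equal ch ch′ (proj₂ p) (<-trans (proj₁ p) a<b)))) (proj₁ p))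
      , (≤-trans X₀≤a (<⇒≤ a<b) , b≤X₁ , λ a′ b′ ch′ p → <-irrefl (proj₂ (siblings-intersecting⇒equal ch ch′ (<-trans a<b (proj₂ p)) (proj₁ p))) (proj₂ p))
      where
      X₀≤a : X₀ ≤ a
      X₀≤a = proj₁ (child-within ch)
      b≤X₁ : b ≤ X₁
      b≤X₁ = proj₂ (child-within ch)
      a<b : a < b
      a<b = child-< ch

  siblings-equal-or-disjoint : ∀ {y₀ y₁ z₀ z₁} → ChildOfX y₀ y₁ → ChildOfX z₀ z₁ → (y₀ ≡ z₀ × y₁ ≡ z₁) ⊎ (y₁ ≤ z₀ ⊎ z₁ ≤ y₀)
  siblings-equal-or-disjoint {y₀} {y₁} {z₀} {z₁} y z with y₀ <? z₁ | z₀ <? y₁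
  ... | yes y₀<z₁ | yes z₀<y₁ = inj₁ (siblings-intersecting⇒equal y z y₀<z₁ z₀<y₁)
  ... | no y₀≮z₁ | _ = inj₂ (inj₂ (≮⇒≥ y₀≮z₁))
  ... | yes _ | no z₀≮y₁ = inj₂ (inj₁ (≮⇒≥ z₀≮y₁))

  child-within-block : ∀ {i j a b} → Boundary i → Boundary j → ChildOfX a b → a < j → i < b → i ≤ a × b ≤ j
  child-within-block bi bj ch aj ib =
    ≮⇒≥ (λ a<i → boundary-not-inside bi ch (a<i , ib)) , ≮⇒≥ (λ j<b → boundary-not-inside bj ch (aj , j<b))

  abstract
    child-starting-at : ∀ {i} → Boundary i → i < X₁ → ∃ λ b → ChildOfX i b
    child-starting-at {i} bi i<X₁ = starting (covering-child i (boundary-≥X₀ bi) i<X₁)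
      where
      starting : (∃₂ λ a b → ChildOfX a b × a ≤ i × i < b) → ∃ λ b → ChildOfX i b
      starting (a , b , ch , a≤i , i<b) = b , subst (λ z → ChildOfX z b) (≤-antisym a≤i (≮⇒≥ (λ a<i → boundary-not-inside bi ch (a<i , i<b)))) ch

  abstract
    child-ending-at : ∀ {j} → Boundary j → X₀ < j → ∃ λ a → ChildOfX a j
    child-ending-at {suc j} bj X₀<j = ending (covering-child j (s≤s⁻¹ X₀<j) (boundary-≤X₁ bj))
      where
      ending : (∃₂ λ a b → ChildOfX a b × a ≤ j × j < b) → ∃ λ a → ChildOfX a (suc j)
      ending (a , b , ch , a≤j , j<b) = a , subst (ChildOfX a) (≤-antisym (≮⇒≥ (λ 1+j<b → boundary-not-inside bj ch (s≤s a≤j , 1+j<b))) j<b) ch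

  -- For boundaries i < j: the block [i, j) is a union of at least two children.
  SeveralChildren : ℕ → ℕ → Set
  SeveralChildren i j = ∃ λ c → c < j × (Boundary c × i < c)

  severalChildren? : ∀ i j → Dec (SeveralChildren i j)
  severalChildren? i j = anyUpTo? (λ c → boundary? c ×-dec (i <? c)) j

  severalChildren⇒< : ∀ {i j} → SeveralChildren i j → i < j
  severalChildren⇒< (c , cj , _ , ic) = <-trans ic cj

  abstract
    single-child-block : ∀ {i j} → Boundary i → Boundary j → i < j → ¬ SeveralChildren i j → ChildOfX i j
    single-child-block {i} {j} bi bj i<j ¬several = only (child-starting-at bi (<-≤-trans i<j (boundary-≤X₁ bj)))
      where
      only : (∃ λ b → ChildOfX i b) → ChildOfX i j
      only (b , ch) = subst (ChildOfX i) (≤-antisym (proj₂ (child-within-block bi bj ch i<j (child-< ch))) (≮⇒≥ b≮j)) ch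
        where
        b≮j : ¬ b < j
        b≮j b<j = ¬several (b , b<j , proj₂ (child-endpoints-boundary ch) , child-< ch)

  ProperBlock : ℕ → ℕ → Set
  ProperBlock i j = X₀ < i ⊎ j < X₁

  abstract
    -- A strong block of several children would contain the first child strictly, so it is all of X.
    proper-block-not-strong : ∀ {i j} → Boundary i → Boundary j → SeveralChildren i j → ProperBlock i j → ¬ IsStrong i j
    proper-block-not-strong {i} {j} bi bj (c , c<j , bc , i<c) proper st = first-child (child-starting-at bi (<-≤-trans (<-trans i<c c<j) (boundary-≤X₁ bj)))
      where
      first-child : (∃ λ b → ChildOfX i b) → ⊥
      first-child (b , ch) = [ (λ X₀<i → <⇒≱ X₀<i (proj₁ X⊆block)) , (λ j<X₁ → <⇒≱ j<X₁ (proj₂ X⊆block)) ]′ proper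
        where
        b≤c : b ≤ c
        b≤c = proj₂ (child-within-block bi bc ch i<c (child-< ch))
        X⊆block : Within X₀ X₁ i j
        X⊆block = child-maximal ch i j st ((≤-refl , ≤-trans b≤c (<⇒≤ c<j)) , inj₂ (≤-<-trans b≤c c<j))

  abstract
    -- A common range overlapping a block crosses no child, so its endpoints are boundaries too.
    block-overlapping-partner : ∀ {i j} → Boundary i → Boundary j → IsCommon i j → ¬ IsStrong i j →
                                ∃₂ λ k l → IsCommon k l × Overlaps i j k l × Boundary k × Boundary l
    block-overlapping-partner {i} {j} bi bj cij ¬strong = with-boundaries (overlapping-partner cij ¬strong)
      where
      with-boundaries : (∃₂ λ k l → IsCommon k l × Overlaps i j k l) → ∃₂ λ k l → IsCommon k l × Overlaps i j k l × Boundary k × Boundary l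
      with-boundaries (k , l , ckl , ov) = k , l , ckl , ov , boundary-k , boundary-l
        where
        i<l : i < l
        i<l = [ (λ { (i<k , _ , _) → <-trans i<k (isCommon⇒< ckl) }) , (λ { (_ , i<l , _) → i<l }) ]′ ov
        k<j : k < j
        k<j = [ (λ { (_ , k<j , _) → k<j }) , (λ { (k<i , _ , _) → <-trans k<i (isCommon⇒< cij) }) ]′ ov
        k⊆X : Within k l X₀ X₁
        k⊆X = [ (λ X⊆k → ⊥-elim (within⇒¬overlaps (≤-trans (proj₁ X⊆k) (boundary-≥X₀ bi) , ≤-trans (boundary-≤X₁ bj) (proj₂ X⊆k)) ov)) , (λ k⊆X → k⊆X) ]′
                (strong-nested stX ckl (≤-<-trans (boundary-≥X₀ bi) i<l) (<-≤-trans k<j (boundary-≤X₁ bj)))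
        not-in-child : ∀ {a b} → ChildOfX a b → ¬ Within k l a b
        not-in-child {a} {b} ch (a≤k , l≤b) = contains⇒¬overlaps (≤-trans (proj₁ ch⊆block) a≤k , ≤-trans l≤b (proj₂ ch⊆block)) ov
          where
          ch⊆block : i ≤ a × b ≤ j
          ch⊆block = child-within-block bi bj ch (≤-<-trans a≤k k<j) (<-≤-trans i<l l≤b)
        boundary-k : Boundary k
        boundary-k = proj₁ k⊆X , ≤-trans (<⇒≤ (isCommon⇒< ckl)) (proj₂ k⊆X) , λ a b ch p →
          [ (λ a⊆k → <⇒≱ (proj₁ p) (proj₁ a⊆k)) , not-in-child ch ]′ (strong-nested (child-strong ch) ckl (<-trans (proj₁ p) (isCommon⇒< ckl)) (proj₂ p))
        boundary-l : Boundary l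
        boundary-l = ≤-trans (proj₁ k⊆X) (<⇒≤ (isCommon⇒< ckl)) , proj₂ k⊆X , λ a b ch p →
          [ (λ a⊆k → <⇒≱ (proj₂ p) (proj₂ a⊆k)) , not-in-child ch ]′ (strong-nested (child-strong ch) ckl (proj₁ p) (<-trans (isCommon⇒< ckl) (proj₂ p)))

  ChildUnion : ℕ → ℕ → Set
  ChildUnion u₀ u₁ = IsCommon u₀ u₁ × Within u₀ u₁ X₀ X₁ × (∀ a b → ChildOfX a b → a < u₁ → u₀ < b → Within a b u₀ u₁)

  childUnion-closed : ∀ {u₀ u₁ a b} → ChildUnion u₀ u₁ → ChildOfX a b → a < u₁ → u₀ < b → Within a b u₀ u₁
  childUnion-closed (_ , _ , closed) = closed _ _

  Covered : ℕ → ℕ → Set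
  Covered i j = ∀ v → InRange i j v → ∃₂ λ a b → ChildOfX a b × Within a b i j × InRange a b v

  covered⇒within : ∀ {i j} → i < j → j ≤ n → Covered i j → Within i j X₀ X₁
  covered⇒within {i} {zero} () _ _
  covered⇒within {i} {suc j} i<j j<n covered
    with value-in-range ≤-refl i<j j<n | value-in-range (s≤s⁻¹ i<j) ≤-refl j<n
  ... | u , u≡i , u∈ | v , v≡j , v∈ with covered u u∈ | covered v v∈
  ...   | _ , _ , chu , _ , (a≤u , _) | _ , _ , chv , _ , (_ , v<b) =
    ≤-trans (proj₁ (child-within chu)) (subst (_ ≤_) u≡i a≤u) , ≤-trans (subst (λ x → suc x ≤ _) v≡j v<b) (proj₂ (child-within chv))

  abstract
    covered⇒childUnion : ∀ {i j} → IsCommon i j → Covered i j → ChildUnion i j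
    covered⇒childUnion {i} {j} cij covered = cij , covered⇒within (isCommon⇒< cij) (proj₁ cij) covered , closed
      where
      closed : ∀ c d → ChildOfX c d → c < j → i < d → Within c d i j
      closed c d ch c<j i<d with value-in-range {i} {j} {c ⊔ i} (m≤n⊔m c i) (⊔-lub c<j (isCommon⇒< cij)) (proj₁ cij)
      ... | v , v≡c⊔i , v∈ with covered v v∈
      ...   | a , b , chv , v⊆ , (a≤v , v<b) = subst₂ (λ p q → Within p q i j) (proj₁ same) (proj₂ same) v⊆
        where
        same : a ≡ c × b ≡ d
        same = siblings-intersecting⇒equal chv ch (≤-<-trans a≤v (subst (_< d) (sym v≡c⊔i) (⊔-lub (child-< ch) i<d)))
                                                 (≤-<-trans (subst (c ≤_) (sym v≡c⊔i) (m≤m⊔n c i)) v<b)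

  abstract
    containing-child⇒childUnion : ∀ {k l a b} → IsCommon k l → Within k l X₀ X₁ → ChildOfX a b → Within a b k l → ChildUnion k l
    containing-child⇒childUnion {k} {l} {a} {b} ckl J⊆X w w⊆J = ckl , J⊆X , closed
      where
      closed : ∀ c d → ChildOfX c d → c < l → k < d → Within c d k l
      closed c d ch c<l k<d with strong-nested (child-strong ch) ckl c<l k<d
      ... | inj₁ ch⊆J = ch⊆J
      ... | inj₂ J⊆ch = subst₂ (λ p q → Within p q k l) (proj₁ same) (proj₂ same) w⊆J
        where
        same : a ≡ c × b ≡ d
        same = siblings-intersecting⇒equal w ch (<-≤-trans (child-< w) (≤-trans (proj₂ w⊆J) (proj₂ J⊆ch)))
                                               (≤-<-trans (proj₁ J⊆ch) (≤-<-trans (proj₁ w⊆J) (child-< w)))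

    childUnion-boundaries : ∀ {k l} → ChildUnion k l → Boundary k × Boundary l
    childUnion-boundaries {k} {l} union@(ckl , (X₀≤k , l≤X₁) , _) =
        (X₀≤k , ≤-trans (<⇒≤ k<l) l≤X₁ , λ a b ch (a<k , k<b) → <⇒≱ a<k (proj₁ (childUnion-closed union ch (<-trans a<k k<l) k<b)))
      , (≤-trans X₀≤k (<⇒≤ k<l) , l≤X₁ , λ a b ch (a<l , l<b) → <⇒≱ l<b (proj₂ (childUnion-closed union ch a<l (<-trans k<l l<b))))
      where
      k<l : k < l
      k<l = isCommon⇒< ckl

module Linear {n K : ℕ} (P : Perms n K) (X₀ X₁ : ℕ) (stX : Ranges.IsStrong P X₀ X₁) (bigX : suc X₀ < X₁) where
  open Ranges P
  open Node P X₀ X₁ stX bigX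

  CommonRun : ℕ → ℕ → Set
  CommonRun s t = Boundary s × Boundary t × SeveralChildren s t × (∀ i j → Boundary i → Boundary j → s ≤ i → i < j → j ≤ t → IsCommon i j)

  single-child-block-common : ∀ {i j} → Boundary i → Boundary j → i < j → ¬ SeveralChildren i j → IsCommon i j
  single-child-block-common bi bj ij nm = child-common (single-child-block bi bj ij nm)

  abstract
    adjacent-pair-run : ∀ {i c j} → Boundary i → Boundary c → Boundary j → i < c → c < j → ¬ SeveralChildren i c → ¬ SeveralChildren c j → IsCommon i j → CommonRun i j
    adjacent-pair-run {i} {c} {j} bi bc bj ic cj adjacent₁ adjacent₂ common-ij = bi , bj , (c , cj , bc , ic) , blocks
      where
      blocks : ∀ a b → Boundary a → Boundary b → i ≤ a → a < b → b ≤ j → IsCommon a b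
      blocks a b ba bb ia ab bj' with <-cmp a c
      ... | tri< a<c _ _ = continue (≤-antisym (≮⇒≥ (λ i<a → adjacent₁ (a , a<c , ba , i<a))) ia)
        where
        continue : a ≡ i → IsCommon a b
        continue ai with <-cmp b c
        ... | tri< b<c _ _ = ⊥-elim (adjacent₁ (b , b<c , bb , subst (_< b) ai ab))
        ... | tri≈ _ bc' _ = subst₂ IsCommon (sym ai) (sym bc') (single-child-block-common bi bc ic adjacent₁)
        ... | tri> _ _ c<b = subst₂ IsCommon (sym ai) (sym (≤-antisym bj' (≮⇒≥ (λ b<j → adjacent₂ (b , b<j , bb , c<b))))) common-ij
      ... | tri≈ _ ac _ = subst₂ IsCommon (sym ac) (sym (≤-antisym bj' (≮⇒≥ (λ b<j → adjacent₂ (b , b<j , bb , subst (_< b) ac ab))))) (single-child-block-common bc bj cj adjacent₂)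
      ... | tri> _ _ c<a = ⊥-elim (adjacent₂ (a , <-≤-trans ab bj' , ba , c<a))

  CommonAdjacentPair : Set
  CommonAdjacentPair = ∃₂ λ a c → ∃ λ b → Boundary a × Boundary c × Boundary b × a < c × c < b × ¬ SeveralChildren a c × ¬ SeveralChildren c b × IsCommon a b

  abstract
    find-common-adjacent-pair : ∀ fuel i j → j ∸ i ≤ fuel → Boundary i → Boundary j → SeveralChildren i j → ProperBlock i j → IsCommon i j → CommonAdjacentPair
    find-common-adjacent-pair zero i j lim bi bj several proper common-ij = ⊥-elim (<⇒≱ (m<n⇒0<n∸m (severalChildren⇒< several)) lim)
    find-common-adjacent-pair (suc fuel) i j lim bi bj several proper common-ij = shrink (block-overlapping-partner bi bj common-ij (proper-block-not-strong bi bj several proper))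
      where
      shrink : (∃₂ λ k l → IsCommon k l × Overlaps i j k l × Boundary k × Boundary l) → CommonAdjacentPair
      shrink (k , l , common-kl , inj₁ (i<k , k<j , j<l) , bk , bl) = by-sides (severalChildren? i k) (severalChildren? k j)
        where
        by-sides : Dec (SeveralChildren i k) → Dec (SeveralChildren k j) → CommonAdjacentPair
        by-sides (yes several₁) _ = find-common-adjacent-pair fuel i k (s≤s⁻¹ (≤-trans (∸-monoˡ-< k<j (<⇒≤ i<k)) lim)) bi bk several₁ (inj₂ (<-≤-trans k<j (boundary-≤X₁ bj))) (overlap-left common-ij common-kl i<k k<j j<l)
        by-sides (no adjacent₁) (yes several₂) = find-common-adjacent-pair fuel k j (s≤s⁻¹ (≤-trans (∸-monoʳ-< i<k (<⇒≤ k<j)) lim)) bk bj several₂ (inj₁ (≤-<-trans (boundary-≥X₀ bi) i<k)) (overlap-middle common-ij common-kl i<k k<j j<l)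
        by-sides (no adjacent₁) (no adjacent₂) = i , k , j , bi , bk , bj , i<k , k<j , adjacent₁ , adjacent₂ , common-ij
      shrink (k , l , common-kl , inj₂ (k<i , i<l , l<j) , bk , bl) = by-sides (severalChildren? i l) (severalChildren? l j)
        where
        by-sides : Dec (SeveralChildren i l) → Dec (SeveralChildren l j) → CommonAdjacentPair
        by-sides (yes several₁) _ = find-common-adjacent-pair fuel i l (s≤s⁻¹ (≤-trans (∸-monoˡ-< l<j (<⇒≤ i<l)) lim)) bi bl several₁ (inj₂ (<-≤-trans l<j (boundary-≤X₁ bj))) (overlap-middle common-kl common-ij k<i i<l l<j)
        by-sides (no adjacent₁) (yes several₂) = find-common-adjacent-pair fuel l j (s≤s⁻¹ (≤-trans (∸-monoʳ-< i<l (<⇒≤ l<j)) lim)) bl bj several₂ (inj₁ (≤-<-trans (boundary-≥X₀ bi) i<l)) (overlap-right common-kl common-ij k<i i<l l<j)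
        by-sides (no adjacent₁) (no adjacent₂) = i , l , j , bi , bl , bj , i<l , l<j , adjacent₁ , adjacent₂ , common-ij

  run-common : ∀ {s t} → CommonRun s t → ∀ {i j} → Boundary i → Boundary j → s ≤ i → i < j → j ≤ t → IsCommon i j
  run-common (_ , _ , _ , r) bi bj = r _ _ bi bj

  -- The run [s, t) ends with the child [c, t), and [t, t′) is the next child: a common block straddling t
  -- can be pushed, by the overlap lemmas, until it becomes [c, t′).
  module ExtendRight {s t c t'} (run : CommonRun s t) (bc : Boundary c) (sc : s < c) (ct : c < t) (adjacent-ct : ¬ SeveralChildren c t) (bt' : Boundary t') (tt' : t < t') (adjacent-tt′ : ¬ SeveralChildren t t') where
    bs : Boundary s
    bs = proj₁ run
    bt : Boundary t
    bt = proj₁ (proj₂ run)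
    common-st : IsCommon s t
    common-st = run-common run bs bt ≤-refl (<-trans sc ct) ≤-refl
    common-sc : IsCommon s c
    common-sc = run-common run bs bc ≤-refl sc (<⇒≤ ct)
    abstract
      extend-right : ∀ fuel k l → l < fuel → IsCommon k l → Boundary k → Boundary l → s < k → k < t → t < l → IsCommon c t'
      extend-right (suc fuel) k l lim common-kl bk bl sk kt tl = towards-t′ (m≤n⇒m<n∨m≡n t'l)
        where
        kc : k ≤ c
        kc = ≮⇒≥ (λ c<k → adjacent-ct (k , kt , bk , c<k))
        common-cl : IsCommon c l
        common-cl = [ (λ k<c → overlap-right common-sc common-kl sk k<c (<-trans ct tl)) , (λ k≡c → subst (λ z → IsCommon z l) k≡c common-kl) ]′ (m≤n⇒m<n∨m≡n kc)
        t'l : t' ≤ l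
        t'l = ≮⇒≥ (λ l<t' → adjacent-tt′ (l , l<t' , bl , tl))
        l≤fuel : l ≤ fuel
        l≤fuel = s≤s⁻¹ lim
        absorb-partner : (∃₂ λ k2 l2 → IsCommon k2 l2 × Overlaps t l k2 l2 × Boundary k2 × Boundary l2) → IsCommon c t'
        absorb-partner (k2 , l2 , common₂ , inj₁ (t<k2 , k2<l , l<l2) , bk2 , bl2) = extend-right fuel c k2 (<-≤-trans k2<l l≤fuel) (overlap-left common-cl common₂ (<-trans ct t<k2) k2<l l<l2) bc bk2 sc ct t<k2
        absorb-partner (k2 , l2 , common₂ , inj₂ (k2<t , t<l2 , l2<l) , bk2 , bl2) = by-side (s <? k2)
          where
          by-side : Dec (s < k2) → IsCommon c t'
          by-side (yes s<k2) = extend-right fuel k2 l2 (<-≤-trans l2<l l≤fuel) common₂ bk2 bl2 s<k2 k2<t t<l2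
          by-side (no ns) = extend-right fuel c l2 (<-≤-trans l2<l l≤fuel) (overlap-middle common₂ common-cl (≤-<-trans (≮⇒≥ ns) sc) (<-trans ct t<l2) l2<l) bc bl2 sc ct t<l2
        towards-t′ : t' < l ⊎ t' ≡ l → IsCommon c t'
        towards-t′ (inj₂ e) = subst (IsCommon c) (sym e) common-cl
        towards-t′ (inj₁ t'<l) = absorb-partner (block-overlapping-partner bt bl common-tl (proper-block-not-strong bt bl (t' , t'<l , bt' , tt') (inj₁ (≤-<-trans (boundary-≥X₀ bs) (<-trans sc ct)))))
          where
          common-tl : IsCommon t l
          common-tl = overlap-right common-st common-cl sc ct tl

  module ExtendLeft {s t s' c'} (run : CommonRun s t) (bc' : Boundary c') (sc' : s < c') (c't : c' < t) (adjacent-sc′ : ¬ SeveralChildren s c') (bs' : Boundary s') (s's : s' < s) (adjacent-s′s : ¬ SeveralChildren s' s) where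
    bs : Boundary s
    bs = proj₁ run
    bt : Boundary t
    bt = proj₁ (proj₂ run)
    common-st : IsCommon s t
    common-st = run-common run bs bt ≤-refl (<-trans sc' c't) ≤-refl
    common-c′t : IsCommon c' t
    common-c′t = run-common run bc' bt (<⇒≤ sc') c't ≤-refl
    abstract
      extend-left : ∀ fuel k l → s ∸ k < fuel → IsCommon k l → Boundary k → Boundary l → k < s → s < l → l < t → IsCommon s' c'
      extend-left (suc fuel) k l lim common-kl bk bl ks sl lt = towards-s′ (m≤n⇒m<n∨m≡n ks')
        where
        c'l : c' ≤ l
        c'l = ≮⇒≥ (λ l<c' → adjacent-sc′ (l , l<c' , bl , sl))
        common-kc′ : IsCommon k c'
        common-kc′ = [ (λ c'<l → overlap-left common-kl common-c′t (<-trans ks sc') c'<l lt) , (λ c'≡l → subst (IsCommon k) (sym c'≡l) common-kl) ]′ (m≤n⇒m<n∨m≡n c'l)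
        ks' : k ≤ s'
        ks' = ≮⇒≥ (λ s'<k → adjacent-s′s (k , ks , bk , s'<k))
        shorter : ∀ {k2} → k < k2 → k2 ≤ s → s ∸ k2 < fuel
        shorter kk2 k2s = <-≤-trans (∸-monoʳ-< kk2 k2s) (s≤s⁻¹ lim)
        absorb-partner : (∃₂ λ k2 l2 → IsCommon k2 l2 × Overlaps k s k2 l2 × Boundary k2 × Boundary l2) → IsCommon s' c'
        absorb-partner (k2 , l2 , common₂ , inj₁ (k<k2 , k2<s , s<l2) , bk2 , bl2) = by-side (l2 <? t)
          where
          by-side : Dec (l2 < t) → IsCommon s' c'
          by-side (yes l2<t) = extend-left fuel k2 l2 (shorter k<k2 (<⇒≤ k2<s)) common₂ bk2 bl2 k2<s s<l2 l2<t
          by-side (no nl) = extend-left fuel k2 c' (shorter k<k2 (<⇒≤ k2<s)) (overlap-middle common-kc′ common₂ k<k2 (<-trans k2<s sc') (<-≤-trans c't (≮⇒≥ nl))) bk2 bc' k2<s sc' c't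
        absorb-partner (k2 , l2 , common₂ , inj₂ (k2<k , k<l2 , l2<s) , bk2 , bl2) = extend-left fuel l2 c' (shorter k<l2 (<⇒≤ l2<s)) (overlap-right common₂ common-kc′ k2<k k<l2 (<-trans l2<s sc')) bl2 bc' l2<s sc' c't
        towards-s′ : k < s' ⊎ k ≡ s' → IsCommon s' c'
        towards-s′ (inj₂ e) = subst (λ z → IsCommon z c') e common-kc′
        towards-s′ (inj₁ k<s') = absorb-partner (block-overlapping-partner bk bs common-ks (proper-block-not-strong bk bs (s' , s's , bs' , k<s') (inj₂ (<-≤-trans (<-trans sc' c't) (boundary-≤X₁ bt)))))
          where
          common-ks : IsCommon k s
          common-ks = overlap-left common-kc′ common-st ks sc' c't

  abstract
    grow-right : ∀ {s t} → CommonRun s t → ∀ k l → IsCommon k l → Boundary k → Boundary l → s < k → k < t → t < l → ∃ λ t' → t < t' × CommonRun s t'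
    grow-right {s} {t} run k l common-kl bk bl sk kt tl = neighbours (least (λ v → boundary? v ×-dec (t <? v)) l (bl , tl)) (greatest t (λ v → boundary? v ×-dec (v <? t)) (λ v → proj₂) s (proj₁ run , severalChildren⇒< (proj₁ (proj₂ (proj₂ run)))))
      where
      neighbours : (∃ λ m → (Boundary m × t < m) × (∀ v → Boundary v × t < v → m ≤ v)) → (∃ λ m → (Boundary m × m < t) × (∀ v → Boundary v × v < t → v ≤ m)) → ∃ λ t' → t < t' × CommonRun s t'
      neighbours (t' , (bt' , tt') , mn) (c , (bc , ct) , mx) = t' , tt' , (proj₁ run , bt' , (t , tt' , bt , severalChildren⇒< (proj₁ (proj₂ (proj₂ run)))) , run-blocks)
        where
        bt : Boundary t
        bt = proj₁ (proj₂ run)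
        adjacent-ct : ¬ SeveralChildren c t
        adjacent-ct (v , vt , bv , cv) = <⇒≱ cv (mx v (bv , vt))
        adjacent-tt′ : ¬ SeveralChildren t t'
        adjacent-tt′ (v , vt' , bv , tv) = <⇒≱ vt' (mn v (bv , tv))
        sc : s < c
        sc = let (m , mt , bm , sm) = proj₁ (proj₂ (proj₂ run)) in <-≤-trans sm (mx m (bm , mt))
        common-ct′ : IsCommon c t'
        common-ct′ = ExtendRight.extend-right run bc sc ct adjacent-ct bt' tt' adjacent-tt′ (suc l) k l ≤-refl common-kl bk bl sk kt tl
        blocks-to-t′ : ∀ i → Boundary i → s ≤ i → i < t' → IsCommon i t'
        blocks-to-t′ i bi si it' = by-position (<-cmp i c)
          where
          by-position : Tri (i < c) (i ≡ c) (c < i) → IsCommon i t'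
          by-position (tri< i<c _ _) = overlap-union (run-common run bi bt si (<-trans i<c ct) ≤-refl) common-ct′ i<c ct tt'
          by-position (tri≈ _ ic _) = subst (λ z → IsCommon z t') (sym ic) common-ct′
          by-position (tri> _ _ c<i) = subst (λ z → IsCommon z t') (sym (≤-antisym (≮⇒≥ (λ t<i → <⇒≱ it' (mn i (bi , t<i)))) (≮⇒≥ (λ i<t → <⇒≱ c<i (mx i (bi , i<t)))))) (single-child-block-common bt bt' tt' adjacent-tt′)
        run-blocks : ∀ i j → Boundary i → Boundary j → s ≤ i → i < j → j ≤ t' → IsCommon i j
        run-blocks i j bi bj si ij jt' = by-position (j ≤? t)
          where
          by-position : Dec (j ≤ t) → IsCommon i j
          by-position (yes jt) = run-common run bi bj si ij jt
          by-position (no njt) = subst (IsCommon i) (sym e) (blocks-to-t′ i bi si (subst (i <_) e ij))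
            where
            e : j ≡ t'
            e = ≤-antisym jt' (mn j (bj , ≰⇒> njt))

  abstract
    grow-left : ∀ {s t} → CommonRun s t → ∀ k l → IsCommon k l → Boundary k → Boundary l → k < s → s < l → l < t → ∃ λ s' → s' < s × CommonRun s' t
    grow-left {s} {t} run k l common-kl bk bl ks sl lt = neighbours (greatest s (λ v → boundary? v ×-dec (v <? s)) (λ v → proj₂) k (bk , ks)) (least (λ v → boundary? v ×-dec (s <? v)) t (bt , severalChildren⇒< (proj₁ (proj₂ (proj₂ run)))))
      where
      bs : Boundary s
      bs = proj₁ run
      bt : Boundary t
      bt = proj₁ (proj₂ run)
      neighbours : (∃ λ m → (Boundary m × m < s) × (∀ v → Boundary v × v < s → v ≤ m)) → (∃ λ m → (Boundary m × s < m) × (∀ v → Boundary v × s < v → m ≤ v)) → ∃ λ s' → s' < s × CommonRun s' t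
      neighbours (s' , (bs' , s's) , mx) (c' , (bc' , sc') , mn) = s' , s's , (bs' , bt , (s , severalChildren⇒< (proj₁ (proj₂ (proj₂ run))) , bs , s's) , run-blocks)
        where
        c't : c' < t
        c't = let (m , mt , bm , sm) = proj₁ (proj₂ (proj₂ run)) in ≤-<-trans (mn m (bm , sm)) mt
        adjacent-sc′ : ¬ SeveralChildren s c'
        adjacent-sc′ (v , vc' , bv , sv) = <⇒≱ vc' (mn v (bv , sv))
        adjacent-s′s : ¬ SeveralChildren s' s
        adjacent-s′s (v , vs , bv , s'v) = <⇒≱ s'v (mx v (bv , vs))
        common-s′c′ : IsCommon s' c'
        common-s′c′ = ExtendLeft.extend-left run bc' sc' c't adjacent-sc′ bs' s's adjacent-s′s (suc (s ∸ k)) k l ≤-refl common-kl bk bl ks sl lt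
        blocks-from-s′ : ∀ j → Boundary j → s' < j → j ≤ t → IsCommon s' j
        blocks-from-s′ j bj s'j jt = by-position (<-cmp j c')
          where
          by-position : Tri (j < c') (j ≡ c') (c' < j) → IsCommon s' j
          by-position (tri> _ _ c'<j) = overlap-union common-s′c′ (run-common run bs bj ≤-refl (<-trans sc' c'<j) jt) s's sc' c'<j
          by-position (tri≈ _ jc _) = subst (IsCommon s') (sym jc) common-s′c′
          by-position (tri< j<c' _ _) = subst (IsCommon s') (≤-antisym (≮⇒≥ (λ j<s → <⇒≱ s'j (mx j (bj , j<s)))) (≮⇒≥ (λ s<j → <⇒≱ j<c' (mn j (bj , s<j))))) (single-child-block-common bs' bs s's adjacent-s′s)
        run-blocks : ∀ i j → Boundary i → Boundary j → s' ≤ i → i < j → j ≤ t → IsCommon i j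
        run-blocks i j bi bj s'i ij jt = by-position (s ≤? i)
          where
          by-position : Dec (s ≤ i) → IsCommon i j
          by-position (yes si) = run-common run bi bj si ij jt
          by-position (no nsi) = subst (λ z → IsCommon z j) (sym e) (blocks-from-s′ j bj (subst (_< j) e ij) jt)
            where
            e : i ≡ s'
            e = ≤-antisym (mx i (bi , ≰⇒> nsi)) s'i

  measure-right : ∀ {s t t'} → t < t' → s < t → t' ≤ n → n ∸ (t' ∸ s) < n ∸ (t ∸ s)
  measure-right {s} {t} {t'} tt' st t'n = ∸-monoʳ-< (∸-monoˡ-< tt' (<⇒≤ st)) (≤-trans (m∸n≤m t' s) t'n)

  measure-left : ∀ {s' s t} → s' < s → s < t → t ≤ n → n ∸ (t ∸ s') < n ∸ (t ∸ s)
  measure-left {s'} {s} {t} s's st tn = ∸-monoʳ-< (∸-monoʳ-< s's (<⇒≤ st)) (≤-trans (m∸n≤m t s') tn)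

  abstract
    grow-to-X : ∀ fuel s t → n ∸ (t ∸ s) < fuel → CommonRun s t → CommonRun X₀ X₁
    grow-to-X (suc fuel) s t lim run = by-properness ((X₀ <? s) ⊎-dec (t <? X₁))
     where
     bs : Boundary s
     bs = proj₁ run
     bt : Boundary t
     bt = proj₁ (proj₂ run)
     st : s < t
     st = severalChildren⇒< (proj₁ (proj₂ (proj₂ run)))
     by-properness : Dec (ProperBlock s t) → CommonRun X₀ X₁
     by-properness (no ¬proper) = subst₂ CommonRun (sym (≤-antisym (boundary-≥X₀ bs) (≮⇒≥ (λ X₀<s → ¬proper (inj₁ X₀<s))))) (≤-antisym (boundary-≤X₁ bt) (≮⇒≥ (λ t<X₁ → ¬proper (inj₂ t<X₁)))) run
     by-properness (yes proper) = absorb (block-overlapping-partner bs bt (run-common run bs bt ≤-refl st ≤-refl) (proper-block-not-strong bs bt (proj₁ (proj₂ (proj₂ run))) proper))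
      where
      absorb : (∃₂ λ k l → IsCommon k l × Overlaps s t k l × Boundary k × Boundary l) → CommonRun X₀ X₁
      absorb (k , l , common-kl , inj₁ (s<k , k<t , t<l) , bk , bl) = continue (grow-right run k l common-kl bk bl s<k k<t t<l)
        where
        continue : (∃ λ t' → t < t' × CommonRun s t') → CommonRun X₀ X₁
        continue (t' , tt' , run') = grow-to-X fuel s t' (<-≤-trans (measure-right tt' st (≤-trans (boundary-≤X₁ (proj₁ (proj₂ run'))) X₁≤n)) (s≤s⁻¹ lim)) run'
      absorb (k , l , common-kl , inj₂ (k<s , s<l , l<t) , bk , bl) = continue (grow-left run k l common-kl bk bl k<s s<l l<t)
        where
        continue : (∃ λ s' → s' < s × CommonRun s' t) → CommonRun X₀ X₁
        continue (s' , s's , run') = grow-to-X fuel s' t (<-≤-trans (measure-left s's st (≤-trans (boundary-≤X₁ (proj₁ (proj₂ run))) X₁≤n)) (s≤s⁻¹ lim)) run'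

  -- A proper block of several children that is common: the witness that X is a Q-node.
  ProperCommonBlock : Set
  ProperCommonBlock = ∃₂ λ i j → Boundary i × Boundary j × SeveralChildren i j × ProperBlock i j × IsCommon i j

  abstract
    -- Linearity of Q-nodes: shrinking a proper common block by the overlap lemmas gives two adjacent
    -- children with common union, and absorbing overlapping partners grows this run to all of X.
    blocks-common : ProperCommonBlock → ∀ i j → Boundary i → Boundary j → i < j → IsCommon i j
    blocks-common (i₀ , j₀ , bi , bj , several , proper , common) i j bi' bj' ij = from-pair (find-common-adjacent-pair (j₀ ∸ i₀) i₀ j₀ ≤-refl bi bj several proper common)
      where
      from-pair : CommonAdjacentPair → IsCommon i j
      from-pair (a , c , b , ba , bc , bb , ac , cb , adjacent₁ , adjacent₂ , common-ab) = run-common (grow-to-X (suc n) a b (s≤s (m∸n≤m n (b ∸ a))) (adjacent-pair-run ba bc bb ac cb adjacent₁ adjacent₂ common-ab)) bi' bj' (boundary-≥X₀ bi') ij (boundary-≤X₁ bj')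

  abstract
    -- The child at the left end of the range contains it, or the range would be a proper common block.
    strictly-within-some-child : ¬ ProperCommonBlock → ∀ {k l} → IsCommon k l → StrictlyWithin k l X₀ X₁ →
                                 ∃₂ λ a b → ChildOfX a b × Within k l a b
    strictly-within-some-child ¬block {k} {l} common-kl J⊂X = at-k (covering-child k (proj₁ (proj₁ J⊂X)) (<-≤-trans (isCommon⇒< common-kl) (proj₂ (proj₁ J⊂X))))
      where
      at-k : (∃₂ λ a b → ChildOfX a b × a ≤ k × k < b) → ∃₂ λ a b → ChildOfX a b × Within k l a b
      at-k (a , b , w , a≤k , k<b) =
        [ (λ w⊆J → ends-at-l w⊆J (b <? l)) , (λ J⊆w → a , b , w , J⊆w) ]′ (strong-nested (child-strong w) common-kl (≤-<-trans a≤k (isCommon⇒< common-kl)) k<b)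
        where
        ends-at-l : Within a b k l → Dec (b < l) → ∃₂ λ a b → ChildOfX a b × Within k l a b
        ends-at-l w⊆J (no b≮l) = a , b , w , a≤k , ≮⇒≥ b≮l
        ends-at-l w⊆J (yes b<l) = ⊥-elim (¬block (k , l , proj₁ ends , proj₂ ends , (b , b<l , proj₂ (child-endpoints-boundary w) , k<b) , proj₂ J⊂X , common-kl))
          where
          ends : Boundary k × Boundary l
          ends = childUnion-boundaries (containing-child⇒childUnion common-kl (proj₁ J⊂X) w w⊆J)

module NodeNesting {n K : ℕ} (P : Perms n K) (X₀ X₁ : ℕ) (stX : Ranges.IsStrong P X₀ X₁) (bigX : suc X₀ < X₁) (β : ℕ) (β≥1 : 1 ≤ β) where
  open Ranges P
  open Node P X₀ X₁ stX bigX
  open Linear P X₀ X₁ stX bigX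
  open Translate P

  LargeChildUniqueNested : ℕ → ℕ → Set
  LargeChildUniqueNested u₀ u₁ = ∀ y₀ y₁ → ChildOfX y₀ y₁ → Within y₀ y₁ u₀ u₁ → β < y₁ ∸ y₀ →
    IsNested β y₀ y₁ × (∀ z₀ z₁ → ChildOfX z₀ z₁ → Within z₀ z₁ u₀ u₁ → β < z₁ ∸ z₀ → z₀ ≡ y₀ × z₁ ≡ y₁)

  module _ {u₀ u₁ k l} (J⊆U : Within k l u₀ u₁) (long : (u₁ ∸ u₀) ∸ β ≤ l ∸ k) (nested-J : IsNested β k l) where
    private
      k<l : k < l
      k<l = isCommon⇒< (isNested⇒isCommon nested-J)
      meets : ∀ {y₀ y₁} → ChildOfX y₀ y₁ → Within y₀ y₁ u₀ u₁ → β < y₁ ∸ y₀ → y₀ < l × k < y₁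
      meets y y⊆U large = long-meets-large J⊆U y⊆U (<⇒≤ k<l) (<⇒≤ (child-< y)) long large
      is-the-child : ∀ {a b y₀ y₁} → ChildOfX a b → Within k l a b → ChildOfX y₀ y₁ → Within y₀ y₁ u₀ u₁ → β < y₁ ∸ y₀ → y₀ ≡ a × y₁ ≡ b
      is-the-child w J⊆w y y⊆U large =
        uncurry (λ y₀<l k<y₁ → siblings-intersecting⇒equal y w (<-≤-trans y₀<l (proj₂ J⊆w)) (≤-<-trans (proj₁ J⊆w) k<y₁)) (meets y y⊆U large)

    large-children-inside : ChildUnion k l → LargeChildUniqueNested k l → LargeChildUniqueNested u₀ u₁
    large-children-inside J-union inner y₀ y₁ y y⊆U large =
      map₂ (λ unique z₀ z₁ z z⊆U large-z → unique z₀ z₁ z (inside z z⊆U large-z) large-z) (inner y₀ y₁ y (inside y y⊆U large) large)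
      where
      inside : ∀ {y₀ y₁} → ChildOfX y₀ y₁ → Within y₀ y₁ u₀ u₁ → β < y₁ ∸ y₀ → Within y₀ y₁ k l
      inside y y⊆U large = uncurry (childUnion-closed J-union y) (meets y y⊆U large)

    large-child-containing : ∀ {a b} → ChildOfX a b → Within k l a b → Within a b u₀ u₁ → LargeChildUniqueNested u₀ u₁
    large-child-containing {a} {b} w J⊆w w⊆U y₀ y₁ y y⊆U large = the-child (is-the-child w J⊆w y y⊆U large)
      where
      the-child : ∀ {y₀ y₁} → y₀ ≡ a × y₁ ≡ b →
                  IsNested β y₀ y₁ × (∀ z₀ z₁ → ChildOfX z₀ z₁ → Within z₀ z₁ u₀ u₁ → β < z₁ ∸ z₀ → z₀ ≡ y₀ × z₁ ≡ y₁)
      the-child (refl , refl) = nested-within nested-J (child-common w) J⊆w (≤-trans (∸-monoˡ-≤ β (within⇒length≤ w⊆U)) long)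
                              , λ z₀ z₁ z z⊆U large-z → is-the-child w J⊆w z z⊆U large-z

  abstract
    -- Induction along the nesting chain U ⊃ J: the child w at the left end of J either lies in J
    -- (then J is again a union of children) or contains J (then w is the large child).
    large-children-nested : ∀ {u₀ u₁} → IsNested β u₀ u₁ → ChildUnion u₀ u₁ → LargeChildUniqueNested u₀ u₁
    large-children-nested (nsingle i _) _ y₀ y₁ _ y⊆U large =
      ⊥-elim (<⇒≱ (≤-<-trans β≥1 large) (≤-trans (within⇒length≤ y⊆U) (≤-reflexive (m+n∸n≡m 1 i))))
    large-children-nested {u₀} {u₁} (nstep {k = k} {l = l} _ J⊂U nested-J long) (_ , U⊆X , closed) =
      at-k (covering-child k (≤-trans (proj₁ U⊆X) (proj₁ (proj₁ J⊂U))) (<-≤-trans k<l (≤-trans (proj₂ (proj₁ J⊂U)) (proj₂ U⊆X))))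
      where
      cJ : IsCommon k l
      cJ = isNested⇒isCommon nested-J
      k<l : k < l
      k<l = isCommon⇒< cJ
      at-k : (∃₂ λ a b → ChildOfX a b × a ≤ k × k < b) → LargeChildUniqueNested u₀ u₁
      at-k (a , b , w , a≤k , k<b) = [ w-inside , w-contains ]′ (strong-nested (child-strong w) cJ (≤-<-trans a≤k k<l) k<b)
        where
        w-inside : Within a b k l → LargeChildUniqueNested u₀ u₁
        w-inside w⊆J = large-children-inside (proj₁ J⊂U) long nested-J J-union (large-children-nested nested-J J-union)
          where
          J-union : ChildUnion k l
          J-union = containing-child⇒childUnion cJ (within-trans (proj₁ J⊂U) U⊆X) w w⊆J
        w-contains : Within k l a b → LargeChildUniqueNested u₀ u₁
        w-contains J⊆w = large-child-containing (proj₁ J⊂U) long nested-J w J⊆w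
                           (closed a b w (<-≤-trans (≤-<-trans a≤k k<l) (proj₂ (proj₁ J⊂U))) (≤-<-trans (proj₁ (proj₁ J⊂U)) k<b))

  short⇒nested : ∀ {i j} → IsCommon i j → j ∸ i ≤ β → IsNested β i j
  short⇒nested {i} {j} cij short with j ≟ suc i
  ... | yes refl = nsingle i cij
  ... | no j≢1+i = nstep cij ((≤-refl , isCommon⇒< cij) , inj₂ (≤∧≢⇒< (isCommon⇒< cij) (λ e → j≢1+i (sym e))))
                         (nsingle i (isCommon-singleton i (<-≤-trans (isCommon⇒< cij) (proj₁ cij)))) (≤-trans (≤-reflexive (m≤n⇒m∸n≡0 short)) z≤n)

  module Chain (block : ProperCommonBlock) (U₀ U₁ : ℕ)
     (small-or-nested : ∀ y₀ y₁ → ChildOfX y₀ y₁ → Within y₀ y₁ U₀ U₁ → (y₁ ∸ y₀ ≤ β) ⊎ (β < y₁ ∸ y₀ × IsNested β y₀ y₁))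
     (large-unique : ∀ y₀ y₁ z₀ z₁ → ChildOfX y₀ y₁ → ChildOfX z₀ z₁ → Within y₀ y₁ U₀ U₁ → Within z₀ z₁ U₀ U₁ →
                     β < y₁ ∸ y₀ → β < z₁ ∸ z₀ → y₀ ≡ z₀) where
    abstract
      -- Every block is common (linearity), and of its first and last child one is small, so it can be peeled off.
      chain-nested : ∀ fuel u₀ u₁ → u₁ ∸ u₀ < fuel → Boundary u₀ → Boundary u₁ → u₀ < u₁ → Within u₀ u₁ U₀ U₁ → IsNested β u₀ u₁
      chain-nested (suc fuel) u₀ u₁ lim bu₀ bu₁ u₀<u₁ u⊆U = by-children (severalChildren? u₀ u₁)
        where
        common : IsCommon u₀ u₁
        common = blocks-common block u₀ u₁ bu₀ bu₁ u₀<u₁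
        by-children : Dec (SeveralChildren u₀ u₁) → IsNested β u₀ u₁
        by-children (no ¬several) = [ short⇒nested common , proj₂ ]′ (small-or-nested u₀ u₁ (single-child-block bu₀ bu₁ u₀<u₁ ¬several) u⊆U)
        by-children (yes (c , c<u₁ , bc , u₀<c)) =
          peel (child-starting-at bu₀ (<-≤-trans u₀<u₁ (boundary-≤X₁ bu₁))) (child-ending-at bu₁ (≤-<-trans (boundary-≥X₀ bu₀) u₀<u₁))
          where
          first-end≤c : ∀ {e} → ChildOfX u₀ e → e ≤ c
          first-end≤c first = proj₂ (child-within-block bu₀ bc first u₀<c (child-< first))
          c≤last-start : ∀ {a} → ChildOfX a u₁ → c ≤ a
          c≤last-start last = proj₁ (child-within-block bc bu₁ last (child-< last) c<u₁)
          first⊆U : ∀ {e} → ChildOfX u₀ e → Within u₀ e U₀ U₁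
          first⊆U first = within-trans (≤-refl , ≤-trans (first-end≤c first) (<⇒≤ c<u₁)) u⊆U
          last⊆U : ∀ {a} → ChildOfX a u₁ → Within a u₁ U₀ U₁
          last⊆U last = within-trans (≤-trans (<⇒≤ u₀<c) (c≤last-start last) , ≤-refl) u⊆U
          peel-first : ∀ {e} → ChildOfX u₀ e → e ∸ u₀ ≤ β → IsNested β u₀ u₁
          peel-first {e} first first-small =
            nstep common ((<⇒≤ u₀<e , ≤-refl) , inj₁ u₀<e)
                  (chain-nested fuel e u₁ (<-≤-trans (∸-monoʳ-< u₀<e (<⇒≤ e<u₁)) (s≤s⁻¹ lim)) (proj₂ (child-endpoints-boundary first)) bu₁ e<u₁
                                (within-trans (<⇒≤ u₀<e , ≤-refl) u⊆U))
                  (subst (λ z → z ∸ β ≤ u₁ ∸ e) (∸-split (<⇒≤ u₀<e) (<⇒≤ e<u₁)) (small-step-left {e ∸ u₀} {u₁ ∸ e} {β} first-small))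
            where
            u₀<e : u₀ < e
            u₀<e = child-< first
            e<u₁ : e < u₁
            e<u₁ = ≤-<-trans (first-end≤c first) c<u₁
          peel-last : ∀ {a} → ChildOfX a u₁ → u₁ ∸ a ≤ β → IsNested β u₀ u₁
          peel-last {a} last last-small =
            nstep common ((≤-refl , <⇒≤ a<u₁) , inj₂ a<u₁)
                  (chain-nested fuel u₀ a (<-≤-trans (∸-monoˡ-< a<u₁ (<⇒≤ u₀<a)) (s≤s⁻¹ lim)) bu₀ (proj₁ (child-endpoints-boundary last)) u₀<a
                                (within-trans (≤-refl , <⇒≤ a<u₁) u⊆U))
                  (subst (λ z → z ∸ β ≤ a ∸ u₀) (∸-split (<⇒≤ u₀<a) (<⇒≤ a<u₁)) (small-step-right {a ∸ u₀} {u₁ ∸ a} {β} last-small))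
            where
            a<u₁ : a < u₁
            a<u₁ = child-< last
            u₀<a : u₀ < a
            u₀<a = <-≤-trans u₀<c (c≤last-start last)
          peel : (∃ λ e → ChildOfX u₀ e) → (∃ λ a → ChildOfX a u₁) → IsNested β u₀ u₁
          peel (e , first) (a , last) with small-or-nested u₀ e first (first⊆U first) | small-or-nested a u₁ last (last⊆U last)
          ... | inj₁ first-small | _ = peel-first first first-small
          ... | inj₂ _ | inj₁ last-small = peel-last last last-small
          ... | inj₂ (first-large , _) | inj₂ (last-large , _) =
            ⊥-elim (<-irrefl (large-unique u₀ e a u₁ first last (first⊆U first) (last⊆U last) first-large last-large) (<-≤-trans u₀<c (c≤last-start last)))

module NodeLabel {n K : ℕ} (P : Perms n K) (idP : FirstIsId P) (x : Interval n)
                 (stX : Ranges.IsStrong P (Translate.lo P x) (Translate.hi P x)) (bigX : suc (Translate.lo P x) < Translate.hi P x) where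
  open Ranges P
  open Translate P
  open Node P (lo x) (hi x) stX bigX
  open Linear P (lo x) (hi x) stX bigX

  X₀ X₁ : ℕ
  X₀ = lo x
  X₁ = hi x

  properBlock? : ∀ i j → Dec (ProperBlock i j)
  properBlock? i j = (X₀ <? i) ⊎-dec (j <? X₁)

  properCommonBlock? : Dec ProperCommonBlock
  properCommonBlock? = any²<? (suc n) (λ i j g → isCommon-bounded i j (proj₂ (proj₂ (proj₂ (proj₂ g)))))
    (λ i j → boundary? i ×-dec boundary? j ×-dec severalChildren? i j ×-dec properBlock? i j ×-dec isCommon? i j)

  child-lo≤hi : ∀ {z} → Child P x z → proj₁ z F.≤ proj₂ z
  child-lo≤hi ch = proj₁ (proj₁ (proj₁ (proj₂ ch)))

  union? : ∀ (D′ : Interval n → Bool) v → Dec (Union D′ v)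
  union? D′ v = map′ (λ { (a , b , p) → (a , b) , p }) (λ { ((a , b) , p) → a , b , p })
    (FP.any? λ a → FP.any? λ b → (D′ (a , b) Bool.≟ true) ×-dec ((a F.≤? v) ×-dec (v F.≤? b)))

  abstract
    -- The union of D′ is a range of values whose children are exactly those of D′;
    -- two of them make it a block of several children, a missing one makes it proper.
    no-block⇒labelP : ¬ ProperCommonBlock → LabelP P x
    no-block⇒labelP ¬block D′ D′⊆D (z₁ , z₂ , z₁∈ , z₂∈ , z₁≢z₂) (z₀ , z₀-child , z₀∉) union-common =
      as-range (commonSet⇒range idP (union? D′) union-common)
      where
      as-range : (∃₂ λ i j → IsCommon i j × (∀ v → Union D′ v → InRange i j v) × (∀ v → InRange i j v → Union D′ v)) → ⊥
      as-range (i , j , cij , to-range , from-range) = ¬block (i , j , proj₁ ends , proj₂ ends , several , proper , cij)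
        where
        member : ∀ {v} → Union D′ v → ∃ λ z → ChildOfX (lo z) (hi z) × InRange (lo z) (hi z) v × D′ z ≡ true
        member (z , z∈ , v∈z) = z , child→ (D′⊆D z z∈) , ∈I→ z v∈z , z∈
        selected-within : ∀ z → D′ z ≡ true → Within (lo z) (hi z) i j
        selected-within z z∈ = proj₁ (to-range (proj₁ z) (z , z∈ , FP.≤-refl , child-lo≤hi (D′⊆D z z∈)))
                             , proj₂ (to-range (proj₂ z) (z , z∈ , child-lo≤hi (D′⊆D z z∈) , FP.≤-refl))
        covered : Covered i j
        covered v v∈ = in-child (member (from-range v v∈))
          where
          in-child : (∃ λ z → ChildOfX (lo z) (hi z) × InRange (lo z) (hi z) v × D′ z ≡ true) → ∃₂ λ a b → ChildOfX a b × Within a b i j × InRange a b v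
          in-child (z , ch , v∈z , z∈) = lo z , hi z , ch , selected-within z z∈ , v∈z
        union : ChildUnion i j
        union = covered⇒childUnion cij covered
        ends : Boundary i × Boundary j
        ends = childUnion-boundaries union
        between : ∀ {y z} → D′ y ≡ true → D′ z ≡ true → hi y ≤ lo z → SeveralChildren i j
        between {y} {z} y∈ z∈ y≤z = hi y , ≤-<-trans y≤z (<-≤-trans (child-< (child→ (D′⊆D z z∈))) (proj₂ (selected-within z z∈)))
                                 , proj₂ (child-endpoints-boundary (child→ (D′⊆D y y∈)))
                                 , ≤-<-trans (proj₁ (selected-within y y∈)) (child-< (child→ (D′⊆D y y∈)))
        several : SeveralChildren i j
        several = [ (λ { (lo≡ , hi≡) → ⊥-elim (z₁≢z₂ (interval-≡ lo≡ hi≡)) }) , [ between z₁∈ z₂∈ , between z₂∈ z₁∈ ]′ ]′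
                    (siblings-equal-or-disjoint (child→ (D′⊆D z₁ z₁∈)) (child→ (D′⊆D z₂ z₂∈)))
        i≡X₀ : ¬ ProperBlock i j → i ≡ X₀
        i≡X₀ ¬p = ≤-antisym (≮⇒≥ (λ X₀<i → ¬p (inj₁ X₀<i))) (proj₁ (proj₁ (proj₂ union)))
        j≡X₁ : ¬ ProperBlock i j → j ≡ X₁
        j≡X₁ ¬p = ≤-antisym (proj₂ (proj₁ (proj₂ union))) (≮⇒≥ (λ j<X₁ → ¬p (inj₂ j<X₁)))
        z₀′ : ChildOfX (lo z₀) (hi z₀)
        z₀′ = child→ z₀-child
        z₀-selected : ¬ ProperBlock i j → D′ z₀ ≡ true
        z₀-selected ¬p = equal-to-z₀ (member (from-range (proj₁ z₀) ( subst (_≤ lo z₀) (sym (i≡X₀ ¬p)) (proj₁ (child-within z₀′))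
                                                                   , <-≤-trans (child-< z₀′) (subst (hi z₀ ≤_) (sym (j≡X₁ ¬p)) (proj₂ (child-within z₀′))))))
          where
          equal-to-z₀ : (∃ λ z → ChildOfX (lo z) (hi z) × InRange (lo z) (hi z) (proj₁ z₀) × D′ z ≡ true) → D′ z₀ ≡ true
          equal-to-z₀ (z , ch , (z≤v , v<z) , z∈) =
            subst (λ w → D′ w ≡ true) (uncurry interval-≡ (siblings-intersecting⇒equal ch z₀′ (≤-<-trans z≤v (child-< z₀′)) v<z)) z∈
        proper : ProperBlock i j
        proper = decidable-stable (properBlock? i j) (λ ¬p → contradiction (trans (sym (z₀-selected ¬p)) z₀∉) λ ())

  abstract
    -- The children inside a proper common block of several children form a set D′ violating LabelP.
    block⇒¬labelP : ProperCommonBlock → ¬ LabelP P x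
    block⇒¬labelP (i , j , bi , bj , (c , c<j , bc , i<c) , proper , cij) labelP = labelP D′ D′⊆D two not-all union-common
      where
      Inside : Interval n → Set
      Inside z = ChildOfX (lo z) (hi z) × Within (lo z) (hi z) i j
      inside? : ∀ z → Dec (Inside z)
      inside? z = isChild? X₀ X₁ (lo z) (hi z) ×-dec within? (lo z) (hi z) i j
      D′ : Interval n → Bool
      D′ z = isYes (inside? z)
      D′⊆D : ∀ z → D′ z ≡ true → Child P x z
      D′⊆D z z∈ = child← (proj₁ (isYes≡true⇒ (inside? z) z∈))
      i<j : i < j
      i<j = <-trans i<c c<j
      selected : ∀ {a b} → ChildOfX a b → Within a b i j → ∃ λ z → lo z ≡ a × hi z ≡ b × D′ z ≡ true
      selected ch a⊆block = let r = realise (child-common ch) in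
        Realised.interval r , Realised.lo-≡ r , Realised.hi-≡ r , isYes≡true (inside? (Realised.interval r)) (realised-transport r ChildOfX ch , realised-transport r (λ p q → Within p q i j) a⊆block)
      unselected : ∀ {a b} → ChildOfX a b → ¬ Within a b i j → ∃ λ z → Child P x z × D′ z ≡ false
      unselected {a} {b} ch a⊈block = let r = realise (child-common ch) in
        Realised.interval r , child← (realised-transport r ChildOfX ch)
          , isYes≡false (inside? (Realised.interval r)) (λ r-inside → a⊈block (subst₂ (λ p q → Within p q i j) (Realised.lo-≡ r) (Realised.hi-≡ r) (proj₂ r-inside)))
      two : ∃ λ z₁ → ∃ λ z₂ → (D′ z₁ ≡ true) × (D′ z₂ ≡ true) × (z₁ ≢ z₂)
      two = first-two (child-starting-at bi (<-≤-trans i<j (boundary-≤X₁ bj))) (child-starting-at bc (<-≤-trans c<j (boundary-≤X₁ bj)))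
        where
        first-two : (∃ λ b → ChildOfX i b) → (∃ λ b → ChildOfX c b) → ∃ λ z₁ → ∃ λ z₂ → (D′ z₁ ≡ true) × (D′ z₂ ≡ true) × (z₁ ≢ z₂)
        first-two (b₁ , first) (b₂ , second) =
          distinct (selected first (≤-refl , proj₂ (child-within-block bi bj first i<j (child-< first))))
                   (selected second (<⇒≤ i<c , proj₂ (child-within-block bi bj second c<j (<-trans i<c (child-< second)))))
          where
          distinct : (∃ λ z → lo z ≡ i × hi z ≡ b₁ × D′ z ≡ true) → (∃ λ z → lo z ≡ c × hi z ≡ b₂ × D′ z ≡ true) →
                     ∃ λ z₁ → ∃ λ z₂ → (D′ z₁ ≡ true) × (D′ z₂ ≡ true) × (z₁ ≢ z₂)
          distinct (z₁ , lo₁ , _ , z₁∈) (z₂ , lo₂ , _ , z₂∈) = z₁ , z₂ , z₁∈ , z₂∈ , λ z₁≡z₂ → <-irrefl (trans (sym lo₁) (trans (cong lo z₁≡z₂) lo₂)) i<c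
      not-all : ∃ λ z → Child P x z × D′ z ≡ false
      not-all = [ (λ X₀<i → unselected (proj₂ (child-starting-at boundary-X₀ (<-trans ≤-refl bigX))) (λ X₀-inside → <⇒≱ X₀<i (proj₁ X₀-inside)))
                , (λ j<X₁ → unselected (proj₂ (child-ending-at boundary-X₁ (<-trans ≤-refl bigX))) (λ X₁-inside → <⇒≱ j<X₁ (proj₂ X₁-inside))) ]′ proper
      union-common : CommonSet P (Union D′)
      union-common = common-resp to from (proj₂ cij)
        where
        to : ∀ v → InRange i j v → Union D′ v
        to v (i≤v , v<j) = in-child (covering-child (toℕ v) (≤-trans (boundary-≥X₀ bi) i≤v) (<-≤-trans v<j (boundary-≤X₁ bj)))
          where
          in-child : (∃₂ λ a b → ChildOfX a b × a ≤ toℕ v × toℕ v < b) → Union D′ v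
          in-child (a , b , ch , a≤v , v<b) = into (selected ch (child-within-block bi bj ch (≤-<-trans a≤v v<j) (≤-<-trans i≤v v<b)))
            where
            into : (∃ λ z → lo z ≡ a × hi z ≡ b × D′ z ≡ true) → Union D′ v
            into (z , lo≡ , hi≡ , z∈) = z , z∈ , ∈I← z (subst₂ (λ p q → InRange p q v) (sym lo≡) (sym hi≡) (a≤v , v<b))
        from : ∀ v → Union D′ v → InRange i j v
        from v (z , z∈ , v∈z) = within-trans-range (proj₂ (isYes≡true⇒ (inside? z) z∈)) (∈I→ z v∈z)
          where
          within-trans-range : Within (lo z) (hi z) i j → InRange (lo z) (hi z) v → InRange i j v
          within-trans-range (i≤z , z≤j) (z≤v , v<z) = ≤-trans i≤z z≤v , <-≤-trans v<z z≤j

module Theorem {n K : ℕ} (P : Perms n K) (idP : FirstIsId P) (n≥1 : 1 ≤ n) (β : ℕ) (β≥1 : 1 ≤ β)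
               (I : Interval n) (common-I : Common P I) (size≥2 : 2 ≤ size I) where
  open Ranges P
  open Translate P

  SmallOrNested : Set
  SmallOrNested = ∀ x → InDomain P I x → Small β x ⊎ (Large β x × Nested P β x)

  LargeUnique : Set
  LargeUnique = ∀ x y → InDomain P I x → InDomain P I y → Large β x → Large β y → x ≡ y

  Characterisation : Set
  Characterisation = (PInterval P I × ∃ λ x → InDomain P I x × Nested P β x × size I ∸ β ≤ size x)
                   ⊎ (QInterval P I × SmallOrNested × LargeUnique)

  isCommon-I : IsCommon (lo I) (hi I)
  isCommon-I = common→ common-I

  size≡ : ∀ (Y : Interval n) → lo Y < hi Y → size Y ≡ hi Y ∸ lo Y
  size≡ Y lo<hi = size≡hi∸lo Y (s≤s⁻¹ lo<hi)

  I-long : suc (lo I) < hi I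
  I-long = m≤o∸n⇒m+n≤o 2 (<⇒≤ (isCommon⇒< isCommon-I)) (subst (2 ≤_) (size≡hi∸lo I (proj₁ common-I)) size≥2)

  strong-I? : Dec (Strong P I)
  strong-I? = map′ strong← strong→ (isStrong? (lo I) (hi I))

  parent-long : ∀ {x z} → Child P x z → suc (lo x) < hi x
  parent-long ch = long (proj₁ (proj₂ (proj₂ (child→ ch)))) (isCommon⇒< (proj₁ (proj₁ (proj₂ (child→ ch)))))
    where
    long : ∀ {a b x₀ x₁} → StrictlyWithin a b x₀ x₁ → a < b → suc x₀ < x₁
    long ((_ , b≤x₁) , inj₁ x₀<a) a<b = <-≤-trans (≤-<-trans x₀<a a<b) b≤x₁
    long ((x₀≤a , _) , inj₂ b<x₁) a<b = ≤-<-trans (≤-<-trans x₀≤a a<b) b<x₁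

  nested-step : ∀ {i j} → IsNested β i j → suc i < j → ∃₂ λ k l → StrictlyWithin k l i j × IsNested β k l × (j ∸ i) ∸ β ≤ l ∸ k
  nested-step (nsingle i _) 1+i<1+i = ⊥-elim (<-irrefl refl 1+i<1+i)
  nested-step (nstep _ J⊂I nested-J long) _ = _ , _ , J⊂I , nested-J , long

  module LargeChildren (x : Interval n) (stX : IsStrong (lo x) (hi x)) (x-long : suc (lo x) < hi x)
                       (nested-I : IsNested β (lo I) (hi I)) (union : Node.ChildUnion P (lo x) (hi x) stX x-long (lo I) (hi I)) where
    open Node P (lo x) (hi x) stX x-long
    open NodeNesting P (lo x) (hi x) stX x-long β β≥1

    private
      large-nested : LargeChildUniqueNested (lo I) (hi I)
      large-nested = large-children-nested nested-I union
      long-child : ∀ {z} → Child P x z → Large β z → β < hi z ∸ lo z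
      long-child {z} ch large = subst (β <_) (size≡ z (child-< (child→ ch))) large

    child-small-or-nested : ∀ {z} → Child P x z → z ⊆I I → Small β z ⊎ (Large β z × Nested P β z)
    child-small-or-nested {z} ch z⊆I with size z ≤? β
    ... | yes small = inj₁ small
    ... | no ¬small = inj₂ (≰⇒> ¬small , nested← (proj₁ (large-nested (lo z) (hi z) (child→ ch) (⊆→ {z} {I} z⊆I) (long-child ch (≰⇒> ¬small)))) z refl refl)

    large-child-unique : ∀ {y z} → Child P x y → y ⊆I I → Child P x z → z ⊆I I → Large β y → Large β z → y ≡ z
    large-child-unique {y} {z} chy y⊆I chz z⊆I large-y large-z =
      uncurry (λ lo≡ hi≡ → interval-≡ (sym lo≡) (sym hi≡))
        (proj₂ (large-nested (lo y) (hi y) (child→ chy) (⊆→ {y} {I} y⊆I) (long-child chy large-y)) (lo z) (hi z) (child→ chz) (⊆→ {z} {I} z⊆I) (long-child chz large-z))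

  module FromChildren (x : Interval n) (stX : IsStrong (lo x) (hi x)) (x-long : suc (lo x) < hi x)
                      (block : Linear.ProperCommonBlock P (lo x) (hi x) stX x-long)
                      (lo-boundary : Node.Boundary P (lo x) (hi x) stX x-long (lo I)) (hi-boundary : Node.Boundary P (lo x) (hi x) stX x-long (hi I))
                      (domain : ∀ {z} → Child P x z → z ⊆I I → InDomain P I z)
                      (small-or-nested : SmallOrNested) (large-unique : LargeUnique) where
    open Node P (lo x) (hi x) stX x-long
    open NodeNesting P (lo x) (hi x) stX x-long β β≥1

    domain-of : ∀ {y₀ y₁} (ch : ChildOfX y₀ y₁) → Within y₀ y₁ (lo I) (hi I) → InDomain P I (Realised.interval (realise (child-common ch)))
    domain-of ch y⊆I = let r = realise (child-common ch) in
      domain (child← (realised-transport r ChildOfX ch)) (⊆← {Realised.interval r} {I} (realised-transport r (λ p q → Within p q (lo I) (hi I)) y⊆I))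

    child-small-or-nested : ∀ y₀ y₁ → ChildOfX y₀ y₁ → Within y₀ y₁ (lo I) (hi I) → (y₁ ∸ y₀ ≤ β) ⊎ (β < y₁ ∸ y₀ × IsNested β y₀ y₁)
    child-small-or-nested y₀ y₁ ch y⊆I =
      [ (λ small → inj₁ (subst (_≤ β) length small))
      , (λ { (large , nested) → inj₂ (subst (β <_) length large , subst₂ (IsNested β) (Realised.lo-≡ r) (Realised.hi-≡ r) (nested→ nested)) }) ]′
        (small-or-nested (Realised.interval r) (domain-of ch y⊆I))
      where
      r : Realised y₀ y₁
      r = realise (child-common ch)
      length : size (Realised.interval r) ≡ y₁ ∸ y₀
      length = realised-length r (child-< ch)

    large-child-unique : ∀ y₀ y₁ z₀ z₁ → ChildOfX y₀ y₁ → ChildOfX z₀ z₁ → Within y₀ y₁ (lo I) (hi I) → Within z₀ z₁ (lo I) (hi I) →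
                         β < y₁ ∸ y₀ → β < z₁ ∸ z₀ → y₀ ≡ z₀
    large-child-unique y₀ y₁ z₀ z₁ chy chz y⊆I z⊆I large-y large-z =
      trans (sym (Realised.lo-≡ r)) (trans (cong lo same) (Realised.lo-≡ q))
      where
      r : Realised y₀ y₁
      r = realise (child-common chy)
      q : Realised z₀ z₁
      q = realise (child-common chz)
      same : Realised.interval r ≡ Realised.interval q
      same = large-unique (Realised.interval r) (Realised.interval q) (domain-of chy y⊆I) (domain-of chz z⊆I)
                          (subst (β <_) (sym (realised-length r (child-< chy))) large-y) (subst (β <_) (sym (realised-length q (child-< chz))) large-z)

    nested-I : Nested P β I
    nested-I = nested← (Chain.chain-nested block (lo I) (hi I) child-small-or-nested large-child-unique (suc (hi I ∸ lo I)) (lo I) (hi I) ≤-refl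
                                           lo-boundary hi-boundary (isCommon⇒< isCommon-I) (≤-refl , ≤-refl)) I refl refl

  module StrongI (strong : Strong P I) where
    private
      stI : IsStrong (lo I) (hi I)
      stI = strong→ strong
    open Node P (lo I) (hi I) stI I-long
    open Linear P (lo I) (hi I) stI I-long
    open NodeLabel P idP I stI I-long using (no-block⇒labelP; block⇒¬labelP; properCommonBlock?)

    self-union : ChildUnion (lo I) (hi I)
    self-union = isCommon-I , (≤-refl , ≤-refl) , λ a b ch _ _ → child-within ch

    domain-child : ∀ {z} → InDomain P I z → Child P I z
    domain-child (inj₁ (_ , ch)) = ch
    domain-child (inj₂ (¬strong , _)) = ⊥-elim (¬strong strong)

    -- J ⊂ I is nested and long; in a P-node it lies within a child, which is then nested and long as well.
    P-node-forward : ¬ ProperCommonBlock → IsNested β (lo I) (hi I) → ∃ λ x → InDomain P I x × Nested P β x × size I ∸ β ≤ size x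
    P-node-forward ¬block nested-I = from-step (nested-step nested-I I-long)
      where
      from-step : (∃₂ λ k l → StrictlyWithin k l (lo I) (hi I) × IsNested β k l × (hi I ∸ lo I) ∸ β ≤ l ∸ k) →
                  ∃ λ x → InDomain P I x × Nested P β x × size I ∸ β ≤ size x
      from-step (k , l , J⊂I , nested-J , long) = in-child (strictly-within-some-child ¬block (isNested⇒isCommon nested-J) J⊂I)
        where
        in-child : (∃₂ λ a b → ChildOfX a b × Within k l a b) → ∃ λ x → InDomain P I x × Nested P β x × size I ∸ β ≤ size x
        in-child (a , b , ch , J⊆z) =
          z , inj₁ (strong , child← (realised-transport r ChildOfX ch))
            , nested← (nested-within nested-J (child-common ch) J⊆z (≤-trans (∸-monoˡ-≤ β (within⇒length≤ (child-within ch))) long)) z (Realised.lo-≡ r) (Realised.hi-≡ r)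
            , subst₂ (λ u v → u ∸ β ≤ v) (sym (size≡hi∸lo I (proj₁ common-I))) (sym (realised-length r (child-< ch))) (≤-trans long (within⇒length≤ J⊆z))
          where
          r : Realised a b
          r = realise (child-common ch)
          z : Interval n
          z = Realised.interval r

    Q-node-forward : IsNested β (lo I) (hi I) → SmallOrNested × LargeUnique
    Q-node-forward nested-I =
        (λ x x∈ → child-small-or-nested (domain-child x∈) (child-within′ (domain-child x∈)))
      , (λ x y x∈ y∈ → large-child-unique (domain-child x∈) (child-within′ (domain-child x∈)) (domain-child y∈) (child-within′ (domain-child y∈)))
      where
      open LargeChildren I stI I-long nested-I self-union
      child-within′ : ∀ {z} → Child P I z → z ⊆I I
      child-within′ ch = proj₁ (proj₁ (proj₂ (proj₂ ch)))

    forward : Nested P β I → Characterisation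
    forward nested-I = by-label properCommonBlock?
      where
      by-label : Dec ProperCommonBlock → Characterisation
      by-label (yes block) = inj₂ ((common-I , λ P-I → block⇒¬labelP block (proj₂ P-I)) , Q-node-forward (nested→ nested-I))
      by-label (no ¬block) = inj₁ ((strong , no-block⇒labelP ¬block) , P-node-forward ¬block (nested→ nested-I))

    backward : QInterval P I → SmallOrNested → LargeUnique → Nested P β I
    backward Q-I small-or-nested large-unique = by-label properCommonBlock?
      where
      by-label : Dec ProperCommonBlock → Nested P β I
      by-label (yes block) = FromChildren.nested-I I stI I-long block boundary-X₀ boundary-X₁ (λ ch _ → inj₁ (strong , ch)) small-or-nested large-unique
      by-label (no ¬block) = ⊥-elim (proj₂ Q-I (strong , no-block⇒labelP ¬block))

  module OfUnion {x : Interval n} (u : UnionOfChildrenOf P x I) where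
    private
      covering-lo : ∃ λ z → Child P x z × z ⊆I I × proj₁ I ∈I z
      covering-lo = proj₁ (proj₂ (proj₂ u) (proj₁ I)) (FP.≤-refl , proj₁ common-I)

    x-strong : IsStrong (lo x) (hi x)
    x-strong = strong→ (proj₁ u)

    x-long : suc (lo x) < hi x
    x-long = parent-long (proj₁ (proj₂ covering-lo))

    open Node P (lo x) (hi x) x-strong x-long

    union : ChildUnion (lo I) (hi I)
    union = covered⇒childUnion isCommon-I covered
      where
      covered : Covered (lo I) (hi I)
      covered v (i≤v , v<j) = in-child (proj₁ (proj₂ (proj₂ u) v) (i≤v , s≤s⁻¹ v<j))
        where
        in-child : (∃ λ z → Child P x z × z ⊆I I × v ∈I z) → ∃₂ λ a b → ChildOfX a b × Within a b (lo I) (hi I) × InRange a b v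
        in-child (z , ch , z⊆I , v∈z) = lo z , hi z , child→ ch , ⊆→ {z} {I} z⊆I , ∈I→ z v∈z

    I⊆x : Within (lo I) (hi I) (lo x) (hi x)
    I⊆x = proj₁ (proj₂ union)

    -- A child of x′ inside I ⊆ x lies strictly inside x (else I = x would be strong), so x′ ⊆ x.
    inside : ∀ {x′} → ¬ Strong P I → UnionOfChildrenOf P x′ I → Within (lo x′) (hi x′) (lo x) (hi x)
    inside {x′} ¬strong u′ = via (proj₁ (proj₂ (proj₂ u′) (proj₁ I)) (FP.≤-refl , proj₁ common-I))
      where
      via : (∃ λ w → Child P x′ w × w ⊆I I × proj₁ I ∈I w) → Within (lo x′) (hi x′) (lo x) (hi x)
      via (w , w-child , w⊆I , _) = [ w≡x , w⊂x ]′ (within⇒≡⊎strictlyWithin w⊆x)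
        where
        w⊆I′ : Within (lo w) (hi w) (lo I) (hi I)
        w⊆I′ = ⊆→ {w} {I} w⊆I
        w⊆x : Within (lo w) (hi w) (lo x) (hi x)
        w⊆x = within-trans w⊆I′ I⊆x
        w⊂x : StrictlyWithin (lo w) (hi w) (lo x) (hi x) → Within (lo x′) (hi x′) (lo x) (hi x)
        w⊂x = proj₂ (proj₂ (proj₂ (child→ w-child))) (lo x) (hi x) x-strong
        w≡x : lo w ≡ lo x × hi w ≡ hi x → Within (lo x′) (hi x′) (lo x) (hi x)
        w≡x (lo-w≡ , hi-w≡) = ⊥-elim (¬strong (strong← (subst₂ IsStrong (sym lo-I≡) (sym hi-I≡) x-strong)))
          where
          lo-I≡ : lo I ≡ lo x
          lo-I≡ = ≤-antisym (subst (lo I ≤_) lo-w≡ (proj₁ w⊆I′)) (proj₁ I⊆x)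
          hi-I≡ : hi I ≡ hi x
          hi-I≡ = ≤-antisym (proj₂ I⊆x) (subst (_≤ hi I) hi-w≡ (proj₂ w⊆I′))

  union-node-unique : ∀ {x x′} → ¬ Strong P I → UnionOfChildrenOf P x I → UnionOfChildrenOf P x′ I → x ≡ x′
  union-node-unique {x} {x′} ¬strong u u′ =
    interval-≡ (≤-antisym (proj₁ x′⊆x) (proj₁ x⊆x′)) (≤-antisym (proj₂ x⊆x′) (proj₂ x′⊆x))
    where
    x′⊆x : Within (lo x′) (hi x′) (lo x) (hi x)
    x′⊆x = OfUnion.inside u ¬strong u′
    x⊆x′ : Within (lo x) (hi x) (lo x′) (hi x′)
    x⊆x′ = OfUnion.inside u′ ¬strong u

  module NonStrongI (¬strong : ¬ Strong P I) where
    forward : Nested P β I → Characterisation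
    forward nested-I = inj₂ ((common-I , λ P-I → ¬strong (proj₁ P-I)) , small-or-nested , large-unique)
      where
      small-or-nested : SmallOrNested
      small-or-nested x (inj₁ (strong , _)) = ⊥-elim (¬strong strong)
      small-or-nested x (inj₂ (_ , node , u , ch , x⊆I)) =
        LargeChildren.child-small-or-nested node (OfUnion.x-strong u) (OfUnion.x-long u) (nested→ nested-I) (OfUnion.union u) ch x⊆I
      large-unique : LargeUnique
      large-unique x y (inj₁ (strong , _)) _ = ⊥-elim (¬strong strong)
      large-unique x y (inj₂ _) (inj₁ (strong , _)) = ⊥-elim (¬strong strong)
      large-unique x y (inj₂ (_ , node , u , chx , x⊆I)) (inj₂ (_ , node′ , u′ , chy , y⊆I)) =
        LargeChildren.large-child-unique node (OfUnion.x-strong u) (OfUnion.x-long u) (nested→ nested-I) (OfUnion.union u)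
          chx x⊆I (subst (λ w → Child P w y) (sym (union-node-unique ¬strong u u′)) chy) y⊆I

    smallest-strong-superset : ∃₂ λ x₀ x₁ → IsStrong x₀ x₁ × Within (lo I) (hi I) x₀ x₁ ×
                                 (∀ z₀ z₁ → IsStrong z₀ z₁ → Within (lo I) (hi I) z₀ z₁ → x₁ ∸ x₀ ≤ z₁ ∸ z₀)
    smallest-strong-superset =
      smallest (maximise {Superset} (suc n) n (λ a b → n ∸ (b ∸ a)) (λ a b s → isCommon-bounded a b (proj₁ (proj₁ s)))
                         (λ a b → isStrong? a b ×-dec within? (lo I) (hi I) a b) (λ a b _ → m∸n≤m n (b ∸ a)) 0 n whole)
      where
      Superset : ℕ → ℕ → Set
      Superset a b = IsStrong a b × Within (lo I) (hi I) a b
      whole-strong : ∀ k l → IsCommon k l → ¬ Overlaps 0 n k l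
      whole-strong k l ckl (inj₁ (_ , _ , n<l)) = <⇒≱ n<l (proj₁ ckl)
      whole-strong k l ckl (inj₂ (() , _))
      whole : Superset 0 n
      whole = (isCommon-whole n≥1 , whole-strong) , (z≤n , proj₁ isCommon-I)
      smallest : (∃₂ λ a b → Superset a b × (∀ k l → Superset k l → n ∸ (l ∸ k) ≤ n ∸ (b ∸ a))) →
                 ∃₂ λ x₀ x₁ → IsStrong x₀ x₁ × Within (lo I) (hi I) x₀ x₁ × (∀ z₀ z₁ → IsStrong z₀ z₁ → Within (lo I) (hi I) z₀ z₁ → x₁ ∸ x₀ ≤ z₁ ∸ z₀)
      smallest (a , b , (st , I⊆) , longest) =
        a , b , st , I⊆ , λ z₀ z₁ stz I⊆z → ∸-cancelʳ-≤ (≤-trans (m∸n≤m b a) (proj₁ (proj₁ st))) (longest z₀ z₁ (stz , I⊆z))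

    -- With x the smallest strong range containing I, no child of x contains I, so I is a block of x;
    -- as I is not strong it is a proper block of several children, and it is common: x is a Q-node.
    module InSmallest (x : Interval n) (stX : IsStrong (lo x) (hi x)) (I⊆x : Within (lo I) (hi I) (lo x) (hi x))
                      (smallest : ∀ z₀ z₁ → IsStrong z₀ z₁ → Within (lo I) (hi I) z₀ z₁ → hi x ∸ lo x ≤ z₁ ∸ z₀) where
      x-long : suc (lo x) < hi x
      x-long = ≤-<-trans (s≤s (proj₁ I⊆x)) (<-≤-trans I-long (proj₂ I⊆x))
      open Node P (lo x) (hi x) stX x-long
      open Linear P (lo x) (hi x) stX x-long using (ProperCommonBlock)
      open NodeLabel P idP x stX x-long using (properBlock?; block⇒¬labelP)

      union : ChildUnion (lo I) (hi I)
      union = isCommon-I , I⊆x , closed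
        where
        closed : ∀ a b → ChildOfX a b → a < hi I → lo I < b → Within a b (lo I) (hi I)
        closed a b ch a<i₁ i₀<b = [ (λ ch⊆I → ch⊆I) , (λ I⊆ch → ⊥-elim (<⇒≱ (strictlyWithin⇒length< (<⇒≤ (child-< ch)) (proj₁ (proj₂ (proj₂ ch)))) (smallest a b (child-strong ch) I⊆ch))) ]′
                                    (strong-nested (child-strong ch) isCommon-I a<i₁ i₀<b)

      ends : Boundary (lo I) × Boundary (hi I)
      ends = childUnion-boundaries union

      several : SeveralChildren (lo I) (hi I)
      several = decidable-stable (severalChildren? (lo I) (hi I))
        (λ ¬several → ¬strong (strong← (child-strong (single-child-block (proj₁ ends) (proj₂ ends) (isCommon⇒< isCommon-I) ¬several))))

      proper : ProperBlock (lo I) (hi I)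
      proper = decidable-stable (properBlock? (lo I) (hi I)) (λ ¬proper → ¬strong (strong← (subst₂ IsStrong (sym (lo≡ ¬proper)) (sym (hi≡ ¬proper)) stX)))
        where
        lo≡ : ¬ ProperBlock (lo I) (hi I) → lo I ≡ lo x
        lo≡ ¬proper = ≤-antisym (≮⇒≥ (λ x₀<i₀ → ¬proper (inj₁ x₀<i₀))) (proj₁ I⊆x)
        hi≡ : ¬ ProperBlock (lo I) (hi I) → hi I ≡ hi x
        hi≡ ¬proper = ≤-antisym (proj₂ I⊆x) (≮⇒≥ (λ i₁<x₁ → ¬proper (inj₂ i₁<x₁)))

      block : ProperCommonBlock
      block = lo I , hi I , proj₁ ends , proj₂ ends , several , proper , isCommon-I

      union-of-children : UnionOfChildrenOf P x I
      union-of-children = strong← stX , block⇒¬labelP block , λ v → to v , from v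
        where
        to : ∀ v → v ∈I I → ∃ λ z → Child P x z × z ⊆I I × v ∈I z
        to v v∈I = in-child (covering-child (toℕ v) (≤-trans (proj₁ I⊆x) (proj₁ v∈I)) (<-≤-trans (s≤s (proj₂ v∈I)) (proj₂ I⊆x)))
          where
          in-child : (∃₂ λ a b → ChildOfX a b × a ≤ toℕ v × toℕ v < b) → ∃ λ z → Child P x z × z ⊆I I × v ∈I z
          in-child (a , b , ch , a≤v , v<b) =
            Realised.interval r , child← (realised-transport r ChildOfX ch)
              , ⊆← {Realised.interval r} {I} (realised-transport r (λ p q → Within p q (lo I) (hi I)) (childUnion-closed union ch (≤-<-trans a≤v (s≤s (proj₂ v∈I))) (≤-<-trans (proj₁ v∈I) v<b)))
              , ∈I← (Realised.interval r) (realised-transport r (λ p q → InRange p q v) (a≤v , v<b))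
            where
            r : Realised a b
            r = realise (child-common ch)
        from : ∀ v → (∃ λ z → Child P x z × z ⊆I I × v ∈I z) → v ∈I I
        from v (z , _ , z⊆I , v∈z) = ≤-trans (proj₁ z⊆I) (proj₁ v∈z) , ≤-trans (proj₂ v∈z) (proj₂ z⊆I)

      nested-I : SmallOrNested → LargeUnique → Nested P β I
      nested-I = FromChildren.nested-I x stX x-long block (proj₁ ends) (proj₂ ends) (λ ch z⊆I → inj₂ (¬strong , x , union-of-children , ch , z⊆I))

    backward : SmallOrNested → LargeUnique → Nested P β I
    backward = in-smallest smallest-strong-superset
      where
      in-smallest : (∃₂ λ x₀ x₁ → IsStrong x₀ x₁ × Within (lo I) (hi I) x₀ x₁ × (∀ z₀ z₁ → IsStrong z₀ z₁ → Within (lo I) (hi I) z₀ z₁ → x₁ ∸ x₀ ≤ z₁ ∸ z₀)) →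
                    SmallOrNested → LargeUnique → Nested P β I
      in-smallest (x₀ , x₁ , st , I⊆x , smallest) =
        InSmallest.nested-I (Realised.interval r) (realised-transport r IsStrong st) (realised-transport r (Within (lo I) (hi I)) I⊆x)
                            (λ z₀ z₁ stz I⊆z → realised-transport r (λ p q → ∀ z₀ z₁ → IsStrong z₀ z₁ → Within (lo I) (hi I) z₀ z₁ → q ∸ p ≤ z₁ ∸ z₀) smallest z₀ z₁ stz I⊆z)
        where
        r : Realised x₀ x₁
        r = realise (proj₁ st)

  thm : Nested P β I ⇔ Characterisation
  thm = mk⇔ (forward strong-I?) (backward strong-I?)
    where
    forward : Dec (Strong P I) → Nested P β I → Characterisation
    forward (yes strong) = StrongI.forward strong
    forward (no ¬strong) = NonStrongI.forward ¬strong
    backward : Dec (Strong P I) → Characterisation → Nested P β I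
    backward _ (inj₁ ((strong , _) , x , inj₁ (_ , ch) , nested-x , long)) = step I x common-I (proj₁ (proj₂ (proj₂ ch))) nested-x long
    backward _ (inj₁ ((strong , _) , x , inj₂ (¬strong , _) , _)) = ⊥-elim (¬strong strong)
    backward (yes strong) (inj₂ (Q-I , small-or-nested , large-unique)) = StrongI.backward strong Q-I small-or-nested large-unique
    backward (no ¬strong) (inj₂ (_ , small-or-nested , large-unique)) = NonStrongI.backward ¬strong small-or-nested large-unique

theorem3 : ∀ {n K : ℕ} (P : Perms n K) → FirstIsId P → 1 ≤ n →
    (b : ℕ) → 1 ≤ b →
    (I : Interval n) → Common P I → 2 ≤ size I →
    Nested P b I ⇔
      ((PInterval P I × ∃ λ x → InDomain P I x × Nested P b x × size I ∸ b ≤ size x)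
      ⊎ (QInterval P I
         × (∀ x → InDomain P I x → Small b x ⊎ (Large b x × Nested P b x))
         × (∀ x y → InDomain P I x → InDomain P I y → Large b x → Large b y → x ≡ y)))
theorem3 P P₁≡id n≥1 b b≥1 I common-I size≥2 = Theorem.thm P P₁≡id n≥1 b b≥1 I common-I size≥2
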